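{- For all integers $p\ge1$, $$A^{(p)}(t,z)=\sum_{w\in Asc(p)}t^{|w|}z^{|w|_0}=1+\sum_{n\ge0}\binom{p-1+n}{n}\frac{zt}{(1-zt)^{n+1}}\prod_{i=1}^n\left(1-(1-t)^i\right).$$
   Context: For a finite integer sequence $(a_1,\dots,a_i)$, $\mathrm{asc}(a_1,\dots,a_i)=|\{j:1\le j<i,\ a_j<a_{j+1}\}|$. For an integer $p\ge1$, a $p$-ascent sequence of length $n\ge1$ is a sequence $(a_1,\dots,a_n)$ of nonnegative integers with $a_1=0$ and $a_i\le p+\mathrm{asc}(a_1,\dots,a_{i-1})$ for all $2\le i\le n$; the empty word is also a $p$-ascent sequence. $Asc(p)$ is the set of all $p$-ascent sequences, $|w|$ is the length of $w$ and $|w|_0$ the number of zeros in $w$. -}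

module Defs where

open import Data.Nat using (ℕ; zero; suc; _≤_; _<ᵇ_; _∸_)
import Data.Nat as N
open import Data.Integer using (ℤ; +_; _+_; _-_; _*_)
open import Data.List using (List; []; _∷_; _++_; length)
open import Data.List.Membership.Propositional using (_∈_)
open import Data.List.Relation.Unary.Unique.Propositional using (Unique)
open import Data.Product using (Σ; _×_; ∃-syntax)
open import Data.Bool using (if_then_else_)
open import Function.Bundles using (_⇔_)
open import Relation.Binary.PropositionalEquality using (_≡_; _≢_)

asc : List ℕ → ℕ
asc []            = 0
asc (x ∷ [])      = 0
asc (x ∷ y ∷ r)   = (if x <ᵇ y then 1 else 0) N.+ asc (y ∷ r)

zeros : List ℕ → ℕ
zeros []          = 0
zeros (zero ∷ r)  = suc (zeros r)
zeros (suc _ ∷ r) = zeros r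

-- w is a p-ascent sequence: the first letter (if any) is 0, and every
-- letter a_i with i ≥ 2 (i.e. preceded by a nonempty prefix u = a_1..a_{i-1})
-- satisfies a_i ≤ p + asc(u).  The empty word satisfies this vacuously.
IsPAscent : ℕ → List ℕ → Set
IsPAscent p w =
  (∀ x v → w ≡ x ∷ v → x ≡ 0) ×
  (∀ (u : List ℕ) (x : ℕ) (v : List ℕ) → w ≡ u ++ (x ∷ v) → u ≢ [] → x ≤ p N.+ asc u)

CountIs : (List ℕ → Set) → ℕ → Set
CountIs P c = Σ (List (List ℕ)) λ L → Unique L × (∀ w → (w ∈ L) ⇔ P w) × length L ≡ c

-- formal power series in t and z with integer coefficients:
-- f i j is the coefficient of t^i z^j

FPS : Set
FPS = ℕ → ℕ → ℤ

_≈ₛ_ : FPS → FPS → Set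
f ≈ₛ g = ∀ i j → f i j ≡ g i j

oneₛ : FPS
oneₛ zero zero = + 1
oneₛ _    _    = + 0

tₛ : FPS
tₛ 1 zero = + 1
tₛ _ _    = + 0

zₛ : FPS
zₛ zero 1 = + 1
zₛ _ _    = + 0

_+ₛ_ : FPS → FPS → FPS
(f +ₛ g) i j = f i j + g i j

_-ₛ_ : FPS → FPS → FPS
(f -ₛ g) i j = f i j - g i j

_•ₛ_ : ℤ → FPS → FPS
(k •ₛ f) i j = k * f i j

sumTo : ℕ → (ℕ → ℤ) → ℤ
sumTo zero    h = h zero
sumTo (suc n) h = sumTo n h + h (suc n)

_*ₛ_ : FPS → FPS → FPS
(f *ₛ g) i j = sumTo i λ a → sumTo j λ b → f a b * g (i ∸ a) (j ∸ b)

_^ₛ_ : FPS → ℕ → FPS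
f ^ₛ zero  = oneₛ
f ^ₛ suc n = f *ₛ (f ^ₛ n)

prodₛ : ℕ → (ℕ → FPS) → FPS
prodₛ zero    h = oneₛ
prodₛ (suc n) h = prodₛ n h *ₛ h (suc n)

partialₛ : (ℕ → FPS) → ℕ → FPS
partialₛ F zero    = λ _ _ → + 0
partialₛ F (suc M) = partialₛ F M +ₛ F M

HasSum : (ℕ → FPS) → FPS → Set
HasSum F S = ∀ i j → ∃[ N ] (∀ M → N ≤ M → partialₛ F M i j ≡ S i j)

module Submission where

-- After its initial 0, a p-ascent sequence is built letter by letter from the state (s, l): the current
-- bound s = p + asc and the previous letter l.  The number count M K s l of continuations with M nonzero
-- letters and K zeros obeys a linear recursion in (M, K) at l = 0 and a shift relation l ↦ l + 1.  With
-- q = 1 − t, Pₙ = ∏ᵢ₌₁ⁿ (1 − qⁱ) and aₛₗₙ = [xⁿ] (1 − x)^-(s−l) (1 − q x)^-l, the numbers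
-- Σₙ C(n + K, K) [t^M] aₛₗₙ Pₙ satisfy the same relations; the heart of it is the telescoping identity
-- t Σₓ₌₁ˢ a₍ₛ₊₁₎ₓₙ = (1 − qⁿ⁺¹) aₛ₀₍ₙ₊₁₎.  For s = p and l = 0 these are the coefficients of the
-- right-hand side, because G = 1/(1 − zt) makes zt Gⁿ⁺¹ the diagonal series Σₖ C(n + k, k) (zt)ᵏ⁺¹.

open import Algebra.Bundles using (CommutativeRing)

module Sum-from-one {a} {A : Set a} (_+_ : A → A → A) (0# : A) where

  open import Data.Nat using (ℕ; zero; suc)

  Σ₁ : ℕ → (ℕ → A) → A
  Σ₁ zero    f = 0#
  Σ₁ (suc k) f = Σ₁ k f + f (suc k)

module Finite-sums where

  open import Defs using (sumTo)
  open import Data.Nat as ℕ using (ℕ; zero; suc; _∸_; _≤_; _<_; z≤n; s≤s)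
  import Data.Nat.Properties as ℕ
  open import Data.Integer using (ℤ; +_; _+_; _*_; -_; _-_)
  import Data.Integer.Properties as ℤ
  open import Algebra.Properties.CommutativeSemigroup ℤ.+-commutativeSemigroup using (interchange)
  open import Relation.Binary.PropositionalEquality
  open import Relation.Nullary using (yes; no)
  open import Function using (_∘_)

  sumTo-cong≤ : ∀ n {f g : ℕ → ℤ} → (∀ a → a ≤ n → f a ≡ g a) → sumTo n f ≡ sumTo n g
  sumTo-cong≤ zero    eq = eq 0 z≤n
  sumTo-cong≤ (suc n) eq = cong₂ _+_ (sumTo-cong≤ n (λ a a≤n → eq a (ℕ.m≤n⇒m≤1+n a≤n))) (eq (suc n) ℕ.≤-refl)

  sumTo-cong : ∀ n {f g : ℕ → ℤ} → (∀ a → f a ≡ g a) → sumTo n f ≡ sumTo n g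
  sumTo-cong n eq = sumTo-cong≤ n (λ a _ → eq a)

  sumTo-zero : ∀ n {f : ℕ → ℤ} → (∀ a → a ≤ n → f a ≡ + 0) → sumTo n f ≡ + 0
  sumTo-zero zero    eq = eq 0 z≤n
  sumTo-zero (suc n) eq = cong₂ _+_ (sumTo-zero n (λ a a≤n → eq a (ℕ.m≤n⇒m≤1+n a≤n))) (eq (suc n) ℕ.≤-refl)

  sumTo-+ : ∀ n (f g : ℕ → ℤ) → sumTo n (λ a → f a + g a) ≡ sumTo n f + sumTo n g
  sumTo-+ zero    f g = refl
  sumTo-+ (suc n) f g rewrite sumTo-+ n f g = interchange (sumTo n f) (sumTo n g) (f (suc n)) (g (suc n))

  sumTo-neg : ∀ n (f : ℕ → ℤ) → sumTo n (λ a → - f a) ≡ - sumTo n f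
  sumTo-neg zero    f = refl
  sumTo-neg (suc n) f rewrite sumTo-neg n f = sym (ℤ.neg-distrib-+ (sumTo n f) (f (suc n)))

  sumTo-sub : ∀ n (f g : ℕ → ℤ) → sumTo n (λ a → f a - g a) ≡ sumTo n f - sumTo n g
  sumTo-sub n f g = trans (sumTo-+ n f (λ a → - g a)) (cong (_+_ (sumTo n f)) (sumTo-neg n g))

  *-sumTo : ∀ n (c : ℤ) (f : ℕ → ℤ) → c * sumTo n f ≡ sumTo n (λ a → c * f a)
  *-sumTo zero    c f = refl
  *-sumTo (suc n) c f = trans (ℤ.*-distribˡ-+ c (sumTo n f) (f (suc n))) (cong (_+ c * f (suc n)) (*-sumTo n c f))

  sumTo-* : ∀ n (c : ℤ) (f : ℕ → ℤ) → sumTo n f * c ≡ sumTo n (λ a → f a * c)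
  sumTo-* n c f = trans (ℤ.*-comm (sumTo n f) c) (trans (*-sumTo n c f) (sumTo-cong n (λ a → ℤ.*-comm c (f a))))

  sumTo-suc : ∀ n (f : ℕ → ℤ) → sumTo (suc n) f ≡ f 0 + sumTo n (λ a → f (suc a))
  sumTo-suc zero    f = refl
  sumTo-suc (suc n) f rewrite sumTo-suc n f = ℤ.+-assoc (f 0) (sumTo n (λ a → f (suc a))) (f (suc (suc n)))

  sumTo-reverse : ∀ n (f : ℕ → ℤ) → sumTo n f ≡ sumTo n (λ a → f (n ∸ a))
  sumTo-reverse zero    f = refl
  sumTo-reverse (suc n) f =
    trans (cong (_+ f (suc n)) (sumTo-reverse n f))
      (trans (ℤ.+-comm _ (f (suc n))) (sym (sumTo-suc n (λ a → f (suc n ∸ a)))))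

  sumTo-single : ∀ n k (f : ℕ → ℤ) → k ≤ n → (∀ a → a ≤ n → a ≢ k → f a ≡ + 0) → sumTo n f ≡ f k
  sumTo-single zero .zero f z≤n _ = refl
  sumTo-single (suc n) k f k≤1+n off with k ℕ.≟ suc n
  ... | yes refl = trans (cong (_+ f (suc n)) (sumTo-zero n (λ a a≤n → off a (ℕ.m≤n⇒m≤1+n a≤n) (ℕ.<⇒≢ (s≤s a≤n)))))
                     (ℤ.+-identityˡ _)
  ... | no k≢1+n = trans (cong₂ _+_ (sumTo-single n k f (ℕ.≤-pred (ℕ.≤∧≢⇒< k≤1+n k≢1+n)) (λ a a≤n → off a (ℕ.m≤n⇒m≤1+n a≤n)))
                                    (off (suc n) ℕ.≤-refl (k≢1+n ∘ sym)))
                     (ℤ.+-identityʳ _)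

  sumTo-triangle : ∀ n (F : ℕ → ℕ → ℤ) →
    sumTo n (λ a → sumTo a (F a)) ≡ sumTo n (λ b → sumTo (n ∸ b) (λ c → F (b ℕ.+ c) b))
  sumTo-triangle zero    F = refl
  sumTo-triangle (suc n) F =
    begin
      sumTo n (λ a → sumTo a (F a)) + (sumTo n (F (suc n)) + F (suc n) (suc n))
    ≡⟨ cong (_+ (sumTo n (F (suc n)) + F (suc n) (suc n))) (sumTo-triangle n F) ⟩
      rows + (sumTo n (F (suc n)) + F (suc n) (suc n))
    ≡⟨ sym (ℤ.+-assoc (rows) _ _) ⟩
      (rows + sumTo n (F (suc n))) + F (suc n) (suc n)
    ≡⟨ cong₂ _+_ (sym (sumTo-+ n _ _)) (cong (λ x → F x (suc n)) (sym (ℕ.+-identityʳ (suc n)))) ⟩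
      sumTo n (λ b → sumTo (n ∸ b) (λ c → F (b ℕ.+ c) b) + F (suc n) b) + F (suc n ℕ.+ 0) (suc n)
    ≡⟨ cong₂ (λ s k → s + sumTo k (λ c → F (suc n ℕ.+ c) (suc n))) (sumTo-cong≤ n extend-row) (sym (ℕ.n∸n≡0 n)) ⟩
      sumTo (suc n) (λ b → sumTo (suc n ∸ b) (λ c → F (b ℕ.+ c) b))
    ∎
    where
    open ≡-Reasoning
    rows : ℤ
    rows = sumTo n (λ b → sumTo (n ∸ b) (λ c → F (b ℕ.+ c) b))
    extend-row : ∀ b → b ≤ n → sumTo (n ∸ b) (λ c → F (b ℕ.+ c) b) + F (suc n) b ≡ sumTo (suc n ∸ b) (λ c → F (b ℕ.+ c) b)
    extend-row b b≤n rewrite ℕ.+-∸-assoc 1 b≤n =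
      cong (λ x → sumTo (n ∸ b) (λ c → F (b ℕ.+ c) b) + F x b)
        (sym (trans (ℕ.+-suc b (n ∸ b)) (cong suc (ℕ.m+[n∸m]≡n b≤n))))

  sumTo-truncate : ∀ M N (f : ℕ → ℤ) → M ≤ N → (∀ m → M < m → m ≤ N → f m ≡ + 0) → sumTo N f ≡ sumTo M f
  sumTo-truncate M zero    f z≤n  _    = refl
  sumTo-truncate M (suc N) f M≤1+N tail≡0 with M ℕ.≟ suc N
  ... | yes refl = refl
  ... | no  M≢1+N = trans (cong₂ _+_ (sumTo-truncate M N f M≤N (λ m M<m m≤N → tail≡0 m M<m (ℕ.m≤n⇒m≤1+n m≤N)))
                                      (tail≡0 (suc N) (s≤s M≤N) ℕ.≤-refl))
                          (ℤ.+-identityʳ _)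
    where
    M≤N : M ≤ N
    M≤N = ℕ.≤-pred (ℕ.≤∧≢⇒< M≤1+N M≢1+N)

module Series-ring where

  open import Defs using (sumTo)
  open Finite-sums
  open import Data.Nat as ℕ using (ℕ; zero; suc; _∸_)
  import Data.Nat.Properties as ℕ
  open import Data.Integer using (ℤ; +_; _+_; _*_; -_)
  import Data.Integer.Properties as ℤ
  open import Relation.Binary.PropositionalEquality
  open import Algebra.Bundles using (CommutativeRing)
  open import Algebra.Structures using (IsCommutativeRing)
  open import Data.Product using (_,_)
  open import Level using (0ℓ)

  Series : Set
  Series = ℕ → ℤ

  infix  4 _≈ₜ_
  infixl 6 _+ₜ_
  infixl 7 _⊛_

  _≈ₜ_ : Series → Series → Set
  f ≈ₜ g = ∀ i → f i ≡ g i

  _+ₜ_ : Series → Series → Series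
  (f +ₜ g) i = f i + g i

  -ₜ_ : Series → Series
  (-ₜ f) i = - f i

  0ₜ : Series
  0ₜ _ = + 0

  1ₜ : Series
  1ₜ zero    = + 1
  1ₜ (suc _) = + 0

  _⊛_ : Series → Series → Series
  (f ⊛ g) i = sumTo i (λ a → f a * g (i ∸ a))

  ⊛-cong : ∀ {f f′ g g′} → f ≈ₜ f′ → g ≈ₜ g′ → f ⊛ g ≈ₜ f′ ⊛ g′
  ⊛-cong f≈ g≈ i = sumTo-cong i (λ a → cong₂ _*_ (f≈ a) (g≈ (i ∸ a)))

  ⊛-comm : ∀ f g → f ⊛ g ≈ₜ g ⊛ f
  ⊛-comm f g i = trans (sumTo-reverse i (λ a → f a * g (i ∸ a)))
    (sumTo-cong≤ i (λ a a≤i → trans (cong (λ x → f (i ∸ a) * g x) (ℕ.m∸[m∸n]≡n a≤i)) (ℤ.*-comm (f (i ∸ a)) (g a))))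

  ⊛-assoc : ∀ f g h → (f ⊛ g) ⊛ h ≈ₜ f ⊛ (g ⊛ h)
  ⊛-assoc f g h i =
    begin
      sumTo i (λ a → sumTo a (λ b → f b * g (a ∸ b)) * h (i ∸ a))
    ≡⟨ sumTo-cong i (λ a → sumTo-* a (h (i ∸ a)) (λ b → f b * g (a ∸ b))) ⟩
      sumTo i (λ a → sumTo a (λ b → f b * g (a ∸ b) * h (i ∸ a)))
    ≡⟨ sumTo-triangle i (λ a b → f b * g (a ∸ b) * h (i ∸ a)) ⟩
      sumTo i (λ b → sumTo (i ∸ b) (λ c → f b * g (b ℕ.+ c ∸ b) * h (i ∸ (b ℕ.+ c))))
    ≡⟨ sumTo-cong i (λ b → sumTo-cong (i ∸ b) (λ c →
         trans (cong₂ (λ x y → f b * g x * h y) (ℕ.m+n∸m≡n b c) (sym (ℕ.∸-+-assoc i b c)))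
               (ℤ.*-assoc (f b) (g c) (h (i ∸ b ∸ c))))) ⟩
      sumTo i (λ b → sumTo (i ∸ b) (λ c → f b * (g c * h (i ∸ b ∸ c))))
    ≡⟨ sumTo-cong i (λ b → sym (*-sumTo (i ∸ b) (f b) (λ c → g c * h (i ∸ b ∸ c)))) ⟩
      sumTo i (λ b → f b * sumTo (i ∸ b) (λ c → g c * h (i ∸ b ∸ c)))
    ∎
    where open ≡-Reasoning

  ⊛-distribˡ : ∀ h f g → h ⊛ (f +ₜ g) ≈ₜ h ⊛ f +ₜ h ⊛ g
  ⊛-distribˡ h f g i = trans (sumTo-cong i (λ a → ℤ.*-distribˡ-+ (h a) (f (i ∸ a)) (g (i ∸ a)))) (sumTo-+ i _ _)

  ⊛-distribʳ : ∀ h f g → (f +ₜ g) ⊛ h ≈ₜ f ⊛ h +ₜ g ⊛ h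
  ⊛-distribʳ h f g i = trans (sumTo-cong i (λ a → ℤ.*-distribʳ-+ (h (i ∸ a)) (f a) (g a))) (sumTo-+ i _ _)

  ⊛-identityˡ : ∀ f → 1ₜ ⊛ f ≈ₜ f
  ⊛-identityˡ f zero    = ℤ.*-identityˡ (f 0)
  ⊛-identityˡ f (suc i) = trans (sumTo-suc i (λ a → 1ₜ a * f (suc i ∸ a)))
    (trans (cong₂ _+_ (ℤ.*-identityˡ (f (suc i))) (sumTo-zero i (λ a _ → refl))) (ℤ.+-identityʳ _))

  isCommutativeRing : IsCommutativeRing _≈ₜ_ _+ₜ_ _⊛_ -ₜ_ 0ₜ 1ₜ
  isCommutativeRing = record
    { isRing = record
      { +-isAbelianGroup = record
        { isGroup = record
          { isMonoid = record
            { isSemigroup = record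
              { isMagma = record
                { isEquivalence = record { refl = λ _ → refl ; sym = λ e i → sym (e i) ; trans = λ e e′ i → trans (e i) (e′ i) }
                ; ∙-cong = λ e e′ i → cong₂ _+_ (e i) (e′ i) }
              ; assoc = λ f g h i → ℤ.+-assoc (f i) (g i) (h i) }
            ; identity = (λ f i → ℤ.+-identityˡ (f i)) , (λ f i → ℤ.+-identityʳ (f i)) }
          ; inverse = (λ f i → ℤ.+-inverseˡ (f i)) , (λ f i → ℤ.+-inverseʳ (f i))
          ; ⁻¹-cong = λ e i → cong -_ (e i) }
        ; comm = λ f g i → ℤ.+-comm (f i) (g i) }
      ; *-cong = ⊛-cong
      ; *-assoc = ⊛-assoc
      ; *-identity = ⊛-identityˡ , (λ f i → trans (⊛-comm f 1ₜ i) (⊛-identityˡ f i))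
      ; distrib = ⊛-distribˡ , ⊛-distribʳ }
    ; *-comm = ⊛-comm }

  commutativeRing : CommutativeRing 0ℓ 0ℓ
  commutativeRing = record { isCommutativeRing = isCommutativeRing }

module Negative-binomial {c ℓ} (R : CommutativeRing c ℓ) (q : CommutativeRing.Carrier R) where

  open CommutativeRing R hiding (zero)
  open import Algebra.Properties.Ring ring using (-‿distribˡ-*)
  open import Algebra.Solver.Ring.NaturalCoefficients.Default commutativeSemiring
  open import Data.Nat as ℕ using (ℕ; zero; suc; _∸_; _≤_; _<_)
  import Data.Nat.Properties as ℕ
  open import Relation.Binary.PropositionalEquality as ≡ using (_≡_)
  open import Relation.Binary.Reasoning.Setoid setoid
  open Sum-from-one _+_ 0# public

  t : Carrier
  t = 1# - q

  q+t≈1 : q + t ≈ 1#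
  q+t≈1 = begin
    q + (1# - q)   ≈⟨ solve 3 (λ q o nq → q :+ (o :+ nq) := o :+ (q :+ nq)) refl q 1# (- q) ⟩
    1# + (q - q)   ≈⟨ +-congˡ (-‿inverseʳ q) ⟩
    1# + 0#        ≈⟨ +-identityʳ 1# ⟩
    1#             ∎

  [x+y]-x≈y : ∀ x y → (x + y) - x ≈ y
  [x+y]-x≈y x y = begin
    (x + y) - x    ≈⟨ solve 3 (λ x y nx → (x :+ y) :+ nx := y :+ (x :+ nx)) refl x y (- x) ⟩
    y + (x - x)    ≈⟨ +-congˡ (-‿inverseʳ x) ⟩
    y + 0#         ≈⟨ +-identityʳ y ⟩
    y              ∎

  [x-y]+[y-z]≈x-z : ∀ x y z → (x - y) + (y - z) ≈ x - z
  [x-y]+[y-z]≈x-z x y z = begin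
    (x - y) + (y - z)     ≈⟨ solve 4 (λ x ny y nz → (x :+ ny) :+ (y :+ nz) := (x :+ nz) :+ (ny :+ y)) refl x (- y) y (- z) ⟩
    (x - z) + (- y + y)   ≈⟨ +-congˡ (-‿inverseˡ y) ⟩
    (x - z) + 0#          ≈⟨ +-identityʳ _ ⟩
    x - z                 ∎

  [1-x]*y≈y-x*y : ∀ x y → (1# - x) * y ≈ y - x * y
  [1-x]*y≈y-x*y x y = begin
    (1# - x) * y       ≈⟨ distribʳ y 1# (- x) ⟩
    1# * y + - x * y   ≈⟨ +-cong (*-identityˡ y) (sym (-‿distribˡ-* x y)) ⟩
    y - x * y          ∎

  qPow : ℕ → Carrier
  qPow zero    = 1#
  qPow (suc n) = q * qPow n

  -- coeff m l n is the coefficient of xⁿ in (1 − x)⁻ᵐ (1 − q x)⁻ˡ.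
  coeff : ℕ → ℕ → ℕ → Carrier
  coeff zero    zero    zero    = 1#
  coeff zero    zero    (suc n) = 0#
  coeff zero    (suc l) zero    = 1#
  coeff zero    (suc l) (suc n) = coeff zero l (suc n) + q * coeff zero (suc l) n
  coeff (suc m) l       zero    = 1#
  coeff (suc m) l       (suc n) = coeff m l (suc n) + coeff (suc m) l n

  coeff-0 : ∀ m l → coeff m l 0 ≡ 1#
  coeff-0 zero    zero    = ≡.refl
  coeff-0 zero    (suc l) = ≡.refl
  coeff-0 (suc m) l       = ≡.refl

  coeff-recˡ : ∀ m l n → coeff m (suc l) (suc n) ≈ coeff m l (suc n) + q * coeff m (suc l) n
  coeff-recˡ zero    l n       = refl
  coeff-recˡ (suc m) l zero    = begin
    coeff m (suc l) 1 + 1#                        ≈⟨ +-congʳ (coeff-recˡ m l 0) ⟩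
    (coeff m l 1 + q * coeff m (suc l) 0) + 1#    ≈⟨ +-congʳ (+-congˡ (*-congˡ (reflexive (coeff-0 m (suc l))))) ⟩
    (coeff m l 1 + q * 1#) + 1#                   ≈⟨ solve 3 (λ a b o → (a :+ b) :+ o := (a :+ o) :+ b) refl (coeff m l 1) (q * 1#) 1# ⟩
    (coeff m l 1 + 1#) + q * 1#                   ∎
  coeff-recˡ (suc m) l (suc n) = begin
    coeff m (suc l) (suc (suc n)) + coeff (suc m) (suc l) (suc n)
      ≈⟨ +-cong (coeff-recˡ m l (suc n)) (coeff-recˡ (suc m) l n) ⟩
    (coeff m l (suc (suc n)) + q * coeff m (suc l) (suc n)) + (coeff (suc m) l (suc n) + q * coeff (suc m) (suc l) n)
      ≈⟨ solve 5 (λ a b c d q → (a :+ q :* b) :+ (c :+ q :* d) := (a :+ c) :+ q :* (b :+ d)) refl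
           (coeff m l (suc (suc n))) (coeff m (suc l) (suc n)) (coeff (suc m) l (suc n)) (coeff (suc m) (suc l) n) q ⟩
    (coeff m l (suc (suc n)) + coeff (suc m) l (suc n)) + q * (coeff m (suc l) (suc n) + coeff (suc m) (suc l) n)
      ∎

  -- The generating-function identity q (1 − x) + t = 1 − q x.
  coeff-split : ∀ m l n → q * coeff m (suc l) n + t * coeff (suc m) (suc l) n ≈ coeff (suc m) l n
  coeff-split m l zero = begin
    q * coeff m (suc l) 0 + t * 1#   ≈⟨ +-congʳ (*-congˡ (reflexive (coeff-0 m (suc l)))) ⟩
    q * 1# + t * 1#                  ≈⟨ sym (distribʳ 1# q t) ⟩
    (q + t) * 1#                     ≈⟨ *-congʳ q+t≈1 ⟩
    1# * 1#                          ≈⟨ *-identityˡ 1# ⟩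
    1#                               ∎
  coeff-split m l (suc n) = begin
    q * coeff m (suc l) (suc n) + t * (coeff m (suc l) (suc n) + coeff (suc m) (suc l) n)
      ≈⟨ solve 4 (λ q t x y → q :* x :+ t :* (x :+ y) := (q :+ t) :* x :+ t :* y) refl
           q t (coeff m (suc l) (suc n)) (coeff (suc m) (suc l) n) ⟩
    (q + t) * coeff m (suc l) (suc n) + t * coeff (suc m) (suc l) n
      ≈⟨ +-congʳ (trans (*-congʳ q+t≈1) (*-identityˡ _)) ⟩
    coeff m (suc l) (suc n) + t * coeff (suc m) (suc l) n
      ≈⟨ +-congʳ (coeff-recˡ m l n) ⟩
    (coeff m l (suc n) + q * coeff m (suc l) n) + t * coeff (suc m) (suc l) n
      ≈⟨ +-assoc _ _ _ ⟩
    coeff m l (suc n) + (q * coeff m (suc l) n + t * coeff (suc m) (suc l) n)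
      ≈⟨ +-congˡ (coeff-split m l n) ⟩
    coeff m l (suc n) + coeff (suc m) l n
      ∎

  coeff-0-l : ∀ l n → coeff 0 l n ≈ qPow n * coeff l 0 n
  coeff-0-l zero    zero    = sym (*-identityˡ 1#)
  coeff-0-l zero    (suc n) = sym (zeroʳ _)
  coeff-0-l (suc l) zero    = sym (*-identityˡ 1#)
  coeff-0-l (suc l) (suc n) = begin
    coeff zero l (suc n) + q * coeff zero (suc l) n
      ≈⟨ +-cong (coeff-0-l l (suc n)) (*-congˡ (coeff-0-l (suc l) n)) ⟩
    q * qPow n * coeff l 0 (suc n) + q * (qPow n * coeff (suc l) 0 n)
      ≈⟨ solve 4 (λ q p a b → q :* p :* a :+ q :* (p :* b) := q :* p :* (a :+ b)) refl q (qPow n) (coeff l 0 (suc n)) (coeff (suc l) 0 n) ⟩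
    q * qPow n * (coeff l 0 (suc n) + coeff (suc l) 0 n)
      ∎

  weight : ℕ → ℕ → ℕ → Carrier
  weight s x n = coeff (s ∸ x) x n

  weight-split : ∀ s x n → x < s → q * weight s (suc x) n + t * weight (suc s) (suc x) n ≈ weight s x n
  weight-split s x n x<s rewrite ℕ.+-∸-assoc 1 x<s = coeff-split (s ∸ suc x) x n

  t*weight-suc : ∀ s x n → x < s →
    t * weight (suc s) (suc x) n ≈ (weight s x n - weight s (suc x) n) + t * weight s (suc x) n
  t*weight-suc s x n x<s = begin
    t * weight (suc s) (suc x) n          ≈⟨ sym ([x+y]-x≈y _ _) ⟩
    (q * w′ + t * weight (suc s) (suc x) n) - q * w′   ≈⟨ +-congʳ (weight-split s x n x<s) ⟩
    weight s x n - q * w′                 ≈⟨ sym ([x-y]+[y-z]≈x-z _ w′ _) ⟩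
    (weight s x n - w′) + (w′ - q * w′)   ≈⟨ +-congˡ (sym ([1-x]*y≈y-x*y q w′)) ⟩
    (weight s x n - w′) + t * w′          ∎
    where w′ = weight s (suc x) n

  weight-telescope : ∀ s n k → k ≤ s →
    t * Σ₁ k (λ x → weight (suc s) x n) ≈ (weight s 0 n - weight s k n) + t * Σ₁ k (λ x → weight s x n)
  weight-telescope s n zero    _   = sym (trans (+-congʳ (-‿inverseʳ _)) (+-identityˡ _))
  weight-telescope s n (suc k) k<s = begin
    t * (Σ₁ k (λ x → weight (suc s) x n) + weight (suc s) (suc k) n)
      ≈⟨ distribˡ t _ _ ⟩
    t * Σ₁ k (λ x → weight (suc s) x n) + t * weight (suc s) (suc k) n
      ≈⟨ +-cong (weight-telescope s n k (ℕ.<⇒≤ k<s)) (t*weight-suc s k n k<s) ⟩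
    ((w₀ - wₖ) + t * Σ₁ k (λ x → weight s x n)) + ((wₖ - wₖ₊₁) + t * wₖ₊₁)
      ≈⟨ solve 4 (λ a b u v → (a :+ u) :+ (b :+ v) := (a :+ b) :+ (u :+ v)) refl (w₀ - wₖ) (wₖ - wₖ₊₁) _ _ ⟩
    ((w₀ - wₖ) + (wₖ - wₖ₊₁)) + (t * Σ₁ k (λ x → weight s x n) + t * wₖ₊₁)
      ≈⟨ +-cong ([x-y]+[y-z]≈x-z w₀ wₖ wₖ₊₁) (sym (distribˡ t _ _)) ⟩
    (w₀ - wₖ₊₁) + t * (Σ₁ k (λ x → weight s x n) + wₖ₊₁)
      ∎
    where
    w₀ = weight s 0 n
    wₖ = weight s k n
    wₖ₊₁ = weight s (suc k) n

  t*Σ₁-weight : ∀ s n → t * Σ₁ s (λ x → weight (suc s) x n) ≈ (1# - qPow (suc n)) * coeff s 0 (suc n)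
  t*Σ₁-weight zero    n = trans (zeroʳ t) (sym (zeroʳ _))
  t*Σ₁-weight (suc s) n = begin
    t * Σ₁ (suc s) (λ x → weight (suc (suc s)) x n)
      ≈⟨ weight-telescope (suc s) n (suc s) ℕ.≤-refl ⟩
    (b - weight (suc s) (suc s) n) + t * (Σ₁ s (λ x → weight (suc s) x n) + weight (suc s) (suc s) n)
      ≈⟨ +-cong (+-congˡ (-‿cong diagonal)) (trans (distribˡ t _ _) (+-cong (t*Σ₁-weight s n) (*-congˡ diagonal))) ⟩
    (b - qPow n * b) + (u * coeff s 0 (suc n) + t * (qPow n * b))
      ≈⟨ solve 3 (λ x y z → x :+ (y :+ z) := y :+ (x :+ z)) refl (b - qPow n * b) (u * coeff s 0 (suc n)) (t * (qPow n * b)) ⟩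
    u * coeff s 0 (suc n) + ((b - qPow n * b) + t * (qPow n * b))
      ≈⟨ +-congˡ (+-congˡ ([1-x]*y≈y-x*y q (qPow n * b))) ⟩
    u * coeff s 0 (suc n) + ((b - qPow n * b) + (qPow n * b - q * (qPow n * b)))
      ≈⟨ +-congˡ ([x-y]+[y-z]≈x-z b (qPow n * b) _) ⟩
    u * coeff s 0 (suc n) + (b - q * (qPow n * b))
      ≈⟨ +-congˡ (trans (+-congˡ (-‿cong (sym (*-assoc q (qPow n) b)))) (sym ([1-x]*y≈y-x*y (qPow (suc n)) b))) ⟩
    u * coeff s 0 (suc n) + u * b
      ≈⟨ sym (distribˡ u _ _) ⟩
    u * (coeff s 0 (suc n) + coeff (suc s) 0 n)
      ∎
    where
    u = 1# - qPow (suc n)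
    b = coeff (suc s) 0 n
    diagonal : weight (suc s) (suc s) n ≈ qPow n * b
    diagonal = trans (reflexive (≡.cong (λ k → coeff k (suc s) n) (ℕ.n∸n≡0 s))) (coeff-0-l (suc s) n)

module Series-count where

  open import Defs using (sumTo)
  open Finite-sums
  open Series-ring
  open import Data.Nat as ℕ using (ℕ; zero; suc; _∸_; _≤_; _<_; z≤n)
  import Data.Nat.Properties as ℕ
  open import Data.Nat.Combinatorics using (_C_; nCn≡1; nCk+nC[k+1]≡[n+1]C[k+1])
  open import Data.Integer using (ℤ; +_; _+_; _*_; -_; _-_)
  import Data.Integer.Properties as ℤ
  open import Relation.Binary.PropositionalEquality
  open import Relation.Nullary using (yes; no; contradiction)
  open import Function using (_∘_)
  open import Data.Integer.Tactic.RingSolver using (solve-∀)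
  open Sum-from-one _+_ (+ 0) renaming (Σ₁ to Σ₁ℤ) public

  multichoose : ℕ → ℕ → ℕ
  multichoose zero    zero    = 1
  multichoose zero    (suc j) = 0
  multichoose (suc m) zero    = 1
  multichoose (suc m) (suc j) = multichoose m (suc j) ℕ.+ multichoose (suc m) j

  multichoose-0 : ∀ m → multichoose m 0 ≡ 1
  multichoose-0 zero    = refl
  multichoose-0 (suc m) = refl

  multichoose-1 : ∀ n → multichoose 1 n ≡ 1
  multichoose-1 zero    = refl
  multichoose-1 (suc n) = multichoose-1 n

  multichoose≡C : ∀ m n → multichoose (suc m) n ≡ (m ℕ.+ n) C n
  multichoose≡C m       zero    = refl
  multichoose≡C zero    (suc n) = trans (multichoose-1 n) (sym (nCn≡1 (suc n)))
  multichoose≡C (suc m) (suc n) = begin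
    multichoose (suc m) (suc n) ℕ.+ multichoose (suc (suc m)) n
      ≡⟨ cong₂ ℕ._+_ (multichoose≡C m (suc n)) (multichoose≡C (suc m) n) ⟩
    (m ℕ.+ suc n) C suc n ℕ.+ (suc m ℕ.+ n) C n
      ≡⟨ cong (λ x → x C suc n ℕ.+ (suc m ℕ.+ n) C n) (ℕ.+-suc m n) ⟩
    (suc m ℕ.+ n) C suc n ℕ.+ (suc m ℕ.+ n) C n
      ≡⟨ ℕ.+-comm ((suc m ℕ.+ n) C suc n) _ ⟩
    (suc m ℕ.+ n) C n ℕ.+ (suc m ℕ.+ n) C suc n
      ≡⟨ nCk+nC[k+1]≡[n+1]C[k+1] (suc m ℕ.+ n) n ⟩
    suc (suc m ℕ.+ n) C suc n
      ≡⟨ cong (_C suc n) (ℕ.+-suc (suc m) n) ⟨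
    (suc m ℕ.+ suc n) C suc n
      ∎
    where open ≡-Reasoning

  C≡multichoose : ∀ p → 1 ≤ p → ∀ n → (p ∸ 1 ℕ.+ n) C n ≡ multichoose p n
  C≡multichoose (suc p) _ n = sym (multichoose≡C p n)

  tₜ : Series
  tₜ (suc zero) = + 1
  tₜ _          = + 0

  qₜ : Series
  qₜ = 1ₜ +ₜ -ₜ tₜ

  open Negative-binomial commutativeRing qₜ public

  t≈tₜ : t ≈ₜ tₜ
  t≈tₜ i = cancel (1ₜ i) (tₜ i)
    where
    cancel : ∀ a b → a + - (a + - b) ≡ b
    cancel = solve-∀

  tₜ-⊛ : ∀ f i → (tₜ ⊛ f) (suc i) ≡ f i
  tₜ-⊛ f i = trans (sumTo-suc i (λ a → tₜ a * f (suc i ∸ a)))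
    (trans (ℤ.+-identityˡ _)
      (trans (sumTo-single i 0 _ z≤n (λ { zero _ 0≢0 → contradiction refl 0≢0 ; (suc a) _ _ → ℤ.*-zeroˡ (f (i ∸ suc a)) }))
        (ℤ.*-identityˡ (f i))))

  constₜ : ℤ → Series
  constₜ c zero    = c
  constₜ c (suc _) = + 0

  constₜ-⊛ : ∀ c f i → (constₜ c ⊛ f) i ≡ c * f i
  constₜ-⊛ c f zero    = refl
  constₜ-⊛ c f (suc i) = trans (sumTo-suc i (λ a → constₜ c a * f (suc i ∸ a)))
    (trans (cong (_+_ (c * f (suc i))) (sumTo-zero i (λ a _ → ℤ.*-zeroˡ (f (i ∸ a))))) (ℤ.+-identityʳ _))

  coeff-l0 : ∀ m n → coeff m 0 n ≈ₜ constₜ (+ multichoose m n)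
  coeff-l0 zero    zero    zero    = refl
  coeff-l0 zero    zero    (suc i) = refl
  coeff-l0 zero    (suc n) zero    = refl
  coeff-l0 zero    (suc n) (suc i) = refl
  coeff-l0 (suc m) zero    zero    = refl
  coeff-l0 (suc m) zero    (suc i) = refl
  coeff-l0 (suc m) (suc n) zero    = trans (cong₂ _+_ (coeff-l0 m (suc n) 0) (coeff-l0 (suc m) n 0))
                                      (ℤ.pos-+ (multichoose m (suc n)) (multichoose (suc m) n))
  coeff-l0 (suc m) (suc n) (suc i) = cong₂ _+_ (coeff-l0 m (suc n) (suc i)) (coeff-l0 (suc m) n (suc i))

  P : ℕ → Series
  P zero    = 1ₜ
  P (suc n) = P n ⊛ (1ₜ +ₜ -ₜ qPow (suc n))

  VanishesBelow : ℕ → Series → Set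
  VanishesBelow n f = ∀ i → i < n → f i ≡ + 0

  qPow-0 : ∀ n → qPow n 0 ≡ + 1
  qPow-0 zero                      = refl
  qPow-0 (suc n) rewrite qPow-0 n = refl

  ⊛-vanishesBelowʳ : ∀ n f g → VanishesBelow n g → VanishesBelow n (f ⊛ g)
  ⊛-vanishesBelowʳ n f g g≈0 i i<n =
    sumTo-zero i (λ b _ → trans (cong (f b *_) (g≈0 (i ∸ b) (ℕ.≤-<-trans (ℕ.m∸n≤m i b) i<n))) (ℤ.*-zeroʳ (f b)))

  ⊛-vanishesBelow-suc : ∀ n f g → VanishesBelow n f → g 0 ≡ + 0 → VanishesBelow (suc n) (f ⊛ g)
  ⊛-vanishesBelow-suc n f g f≈0 g₀≡0 i i≤n = sumTo-zero i term≡0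
    where
    term≡0 : ∀ b → b ≤ i → f b * g (i ∸ b) ≡ + 0
    term≡0 b b≤i with b ℕ.<? n
    ... | yes b<n = trans (cong (_* g (i ∸ b)) (f≈0 b b<n)) (ℤ.*-zeroˡ (g (i ∸ b)))
    ... | no  b≮n = trans (cong (f b *_) (trans (cong g (ℕ.m≤n⇒m∸n≡0 i≤b)) g₀≡0)) (ℤ.*-zeroʳ (f b))
      where
      i≤b : i ≤ b
      i≤b = ℕ.≤-trans (ℕ.≤-pred i≤n) (ℕ.≮⇒≥ b≮n)

  P-vanishesBelow : ∀ n → VanishesBelow n (P n)
  P-vanishesBelow zero    i ()
  P-vanishesBelow (suc n) = ⊛-vanishesBelow-suc n (P n) (1ₜ +ₜ -ₜ qPow (suc n)) (P-vanishesBelow n)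
                              (cong (λ x → + 1 - x) (qPow-0 (suc n)))

  -- ⟦ X ⟧ M K is the coefficient of t^M z^K in Σₙ Xₙ Pₙ (1 − z)^-(n+1); only n ≤ M contribute, as Pₙ = O(tⁿ).
  ⟦_⟧ : (ℕ → Series) → ℕ → ℕ → ℤ
  ⟦ X ⟧ M K = sumTo M (λ n → + multichoose (suc n) K * (X n ⊛ P n) M)

  ⟦⟧-cong : ∀ {X Y : ℕ → Series} M K → (∀ n → X n ≈ₜ Y n) → ⟦ X ⟧ M K ≡ ⟦ Y ⟧ M K
  ⟦⟧-cong M K X≈Y = sumTo-cong M (λ n → cong (+ multichoose (suc n) K *_) (⊛-cong {g = P n} (X≈Y n) (λ _ → refl) M))

  ⟦⟧-+ : ∀ (X Y : ℕ → Series) M K → ⟦ (λ n → X n +ₜ Y n) ⟧ M K ≡ ⟦ X ⟧ M K + ⟦ Y ⟧ M K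
  ⟦⟧-+ X Y M K = trans (sumTo-cong M (λ n → trans (cong (+ multichoose (suc n) K *_) (⊛-distribʳ (P n) (X n) (Y n) M))
    (ℤ.*-distribˡ-+ (+ multichoose (suc n) K) _ _))) (sumTo-+ M _ _)

  ⟦⟧-neg : ∀ (X : ℕ → Series) M K → ⟦ (λ n → -ₜ X n) ⟧ M K ≡ - ⟦ X ⟧ M K
  ⟦⟧-neg X M K = trans (sumTo-cong M (λ n → trans (cong (+ multichoose (suc n) K *_) (neg-⊛ (X n) (P n) M))
    (sym (ℤ.neg-distribʳ-* (+ multichoose (suc n) K) ((X n ⊛ P n) M))))) (sumTo-neg M _)
    where
    neg-⊛ : ∀ f g i → ((-ₜ f) ⊛ g) i ≡ - (f ⊛ g) i
    neg-⊛ f g i = trans (sumTo-cong i (λ b → sym (ℤ.neg-distribˡ-* (f b) (g (i ∸ b))))) (sumTo-neg i _)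

  ⟦⟧-0 : ∀ M K → ⟦ (λ _ → 0ₜ) ⟧ M K ≡ + 0
  ⟦⟧-0 M K = sumTo-zero M (λ n _ → trans (cong (+ multichoose (suc n) K *_) (sumTo-zero M (λ b _ → ℤ.*-zeroˡ (P n (M ∸ b)))))
    (ℤ.*-zeroʳ (+ multichoose (suc n) K)))

  ⟦⟧-Σ₁ : ∀ k (F : ℕ → ℕ → Series) M K → ⟦ (λ n → Σ₁ k (λ x → F x n)) ⟧ M K ≡ Σ₁ℤ k (λ x → ⟦ F x ⟧ M K)
  ⟦⟧-Σ₁ zero    F M K = ⟦⟧-0 M K
  ⟦⟧-Σ₁ (suc k) F M K = trans (⟦⟧-+ (λ n → Σ₁ k (λ x → F x n)) (F (suc k)) M K) (cong (_+ ⟦ F (suc k) ⟧ M K) (⟦⟧-Σ₁ k F M K))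

  ⟦tₜ⊛⟧-0 : ∀ (X : ℕ → Series) K → ⟦ (λ n → tₜ ⊛ X n) ⟧ 0 K ≡ + 0
  ⟦tₜ⊛⟧-0 X K = trans (cong (+ multichoose 1 K *_) (⊛-assoc tₜ (X 0) (P 0) 0)) (ℤ.*-zeroʳ (+ multichoose 1 K))

  -- The extra summand n = M + 1 vanishes since P (M + 1) = O(t^(M+1)).
  ⟦tₜ⊛⟧-suc : ∀ (X : ℕ → Series) M K → ⟦ (λ n → tₜ ⊛ X n) ⟧ (suc M) K ≡ ⟦ X ⟧ M K
  ⟦tₜ⊛⟧-suc X M K = trans (cong₂ _+_ (sumTo-cong M (λ n → cong (+ multichoose (suc n) K *_) (shift n)))
                                     (trans (cong (+ multichoose (suc (suc M)) K *_) top≡0) (ℤ.*-zeroʳ (+ multichoose (suc (suc M)) K))))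
                          (ℤ.+-identityʳ _)
    where
    shift : ∀ n → ((tₜ ⊛ X n) ⊛ P n) (suc M) ≡ (X n ⊛ P n) M
    shift n = trans (⊛-assoc tₜ (X n) (P n) (suc M)) (tₜ-⊛ (X n ⊛ P n) M)
    top≡0 : ((tₜ ⊛ X (suc M)) ⊛ P (suc M)) (suc M) ≡ + 0
    top≡0 = trans (shift (suc M)) (⊛-vanishesBelowʳ (suc M) (X (suc M)) (P (suc M)) (P-vanishesBelow (suc M)) M ℕ.≤-refl)

  ⟦t⊛⟧≡⟦tₜ⊛⟧ : ∀ (X : ℕ → Series) M K → ⟦ (λ n → t ⊛ X n) ⟧ M K ≡ ⟦ (λ n → tₜ ⊛ X n) ⟧ M K
  ⟦t⊛⟧≡⟦tₜ⊛⟧ X M K = ⟦⟧-cong M K (λ n → ⊛-cong {g = X n} t≈tₜ (λ _ → refl))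

  ⟦q⊛⟧ : ∀ (X : ℕ → Series) M K → ⟦ (λ n → qₜ ⊛ X n) ⟧ M K ≡ ⟦ X ⟧ M K - ⟦ (λ n → tₜ ⊛ X n) ⟧ M K
  ⟦q⊛⟧ X M K = trans (⟦⟧-cong M K (λ n → [1-x]*y≈y-x*y tₜ (X n)))
    (trans (⟦⟧-+ X (λ n → -ₜ (tₜ ⊛ X n)) M K) (cong (_+_ (⟦ X ⟧ M K)) (⟦⟧-neg (λ n → tₜ ⊛ X n) M K)))

  seriesCount : ℕ → ℕ → ℕ → ℕ → ℤ
  seriesCount M K s l = ⟦ weight s l ⟧ M K

  seriesCount-split : ∀ s l M K → l < s →
    seriesCount M K s l ≡ (seriesCount M K s (suc l) - ⟦ (λ n → tₜ ⊛ weight s (suc l) n) ⟧ M K)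
                           + ⟦ (λ n → tₜ ⊛ weight (suc s) (suc l) n) ⟧ M K
  seriesCount-split s l M K l<s = begin
    seriesCount M K s l
      ≡⟨ ⟦⟧-cong M K (λ n → sym ∘ weight-split s l n l<s) ⟩
    ⟦ (λ n → qₜ ⊛ weight s (suc l) n +ₜ t ⊛ weight (suc s) (suc l) n) ⟧ M K
      ≡⟨ ⟦⟧-+ (λ n → qₜ ⊛ weight s (suc l) n) (λ n → t ⊛ weight (suc s) (suc l) n) M K ⟩
    ⟦ (λ n → qₜ ⊛ weight s (suc l) n) ⟧ M K + ⟦ (λ n → t ⊛ weight (suc s) (suc l) n) ⟧ M K
      ≡⟨ cong₂ _+_ (⟦q⊛⟧ (weight s (suc l)) M K) (⟦t⊛⟧≡⟦tₜ⊛⟧ (weight (suc s) (suc l)) M K) ⟩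
    _ ∎
    where open ≡-Reasoning

  seriesCount-shift₀ : ∀ s l K → l < s → seriesCount 0 K s l ≡ seriesCount 0 K s (suc l)
  seriesCount-shift₀ s l K l<s = begin
    seriesCount 0 K s l
      ≡⟨ seriesCount-split s l 0 K l<s ⟩
    (seriesCount 0 K s (suc l) - ⟦ (λ n → tₜ ⊛ weight s (suc l) n) ⟧ 0 K) + ⟦ (λ n → tₜ ⊛ weight (suc s) (suc l) n) ⟧ 0 K
      ≡⟨ cong₂ (λ x y → (seriesCount 0 K s (suc l) - x) + y) (⟦tₜ⊛⟧-0 (weight s (suc l)) K) (⟦tₜ⊛⟧-0 (weight (suc s) (suc l)) K) ⟩
    (seriesCount 0 K s (suc l) - + 0) + + 0
      ≡⟨ trans (ℤ.+-identityʳ _) (ℤ.+-identityʳ _) ⟩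
    seriesCount 0 K s (suc l) ∎
    where open ≡-Reasoning

  seriesCount-shift : ∀ s l M K → l < s →
    seriesCount (suc M) K s l + seriesCount M K s (suc l) ≡ seriesCount (suc M) K s (suc l) + seriesCount M K (suc s) (suc l)
  seriesCount-shift s l M K l<s = begin
    seriesCount (suc M) K s l + y
      ≡⟨ cong (_+ y) (seriesCount-split s l (suc M) K l<s) ⟩
    ((x - ⟦ (λ n → tₜ ⊛ weight s (suc l) n) ⟧ (suc M) K) + ⟦ (λ n → tₜ ⊛ weight (suc s) (suc l) n) ⟧ (suc M) K) + y
      ≡⟨ cong₂ (λ u v → ((x - u) + v) + y) (⟦tₜ⊛⟧-suc (weight s (suc l)) M K) (⟦tₜ⊛⟧-suc (weight (suc s) (suc l)) M K) ⟩
    ((x - y) + z) + y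
      ≡⟨ cancel x y z ⟩
    x + z ∎
    where
    open ≡-Reasoning
    x = seriesCount (suc M) K s (suc l)
    y = seriesCount M K s (suc l)
    z = seriesCount M K (suc s) (suc l)
    cancel : ∀ a b c → ((a - b) + c) + b ≡ a + c
    cancel = solve-∀

  coeff-l0⊛P : ∀ s n i → (coeff s 0 n ⊛ P n) i ≡ + multichoose s n * P n i
  coeff-l0⊛P s n i = trans (⊛-cong {g = P n} (coeff-l0 s n) (λ _ → refl) i) (constₜ-⊛ (+ multichoose s n) (P n) i)

  seriesCount-l0 : ∀ s M K → seriesCount M K s 0 ≡ sumTo M (λ n → + multichoose (suc n) K * (+ multichoose s n * P n M))
  seriesCount-l0 s M K = sumTo-cong M (λ n → cong (+ multichoose (suc n) K *_) (coeff-l0⊛P s n M))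

  seriesCount-zero-zero : ∀ s → seriesCount 0 0 s 0 ≡ + 1
  seriesCount-zero-zero s rewrite coeff-l0⊛P s 0 0 | multichoose-0 s = refl

  t*Σ₁-weight⊛P : ∀ s n i → ((t ⊛ Σ₁ s (λ x → weight (suc s) x n)) ⊛ P n) i ≡ + multichoose s (suc n) * P (suc n) i
  t*Σ₁-weight⊛P s n i = begin
    ((t ⊛ Σ₁ s (λ x → weight (suc s) x n)) ⊛ P n) i
      ≡⟨ ⊛-cong {g = P n} (t*Σ₁-weight s n) (λ _ → refl) i ⟩
    ((u ⊛ coeff s 0 (suc n)) ⊛ P n) i
      ≡⟨ ⊛-cong {g = P n} (⊛-comm u (coeff s 0 (suc n))) (λ _ → refl) i ⟩
    ((coeff s 0 (suc n) ⊛ u) ⊛ P n) i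
      ≡⟨ ⊛-assoc (coeff s 0 (suc n)) u (P n) i ⟩
    (coeff s 0 (suc n) ⊛ (u ⊛ P n)) i
      ≡⟨ ⊛-cong {f = coeff s 0 (suc n)} (λ _ → refl) (⊛-comm u (P n)) i ⟩
    (coeff s 0 (suc n) ⊛ P (suc n)) i
      ≡⟨ coeff-l0⊛P s (suc n) i ⟩
    + multichoose s (suc n) * P (suc n) i ∎
    where
    open ≡-Reasoning
    u = 1ₜ +ₜ -ₜ qPow (suc n)

  Σ₁-seriesCount : ∀ s M K →
    sumTo (suc M) (λ n → + multichoose n K * (+ multichoose s n * P n (suc M))) ≡ Σ₁ℤ s (λ x → seriesCount M K (suc s) x)
  Σ₁-seriesCount s M K = begin
    sumTo (suc M) term
      ≡⟨ sumTo-suc M term ⟩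
    term 0 + shifted
      ≡⟨ cong (_+ shifted) (trans (cong (+ multichoose 0 K *_) (ℤ.*-zeroʳ (+ multichoose s 0))) (ℤ.*-zeroʳ (+ multichoose 0 K))) ⟩
    + 0 + shifted
      ≡⟨ trans (ℤ.+-identityˡ shifted) (sym (ℤ.+-identityʳ shifted)) ⟩
    shifted + + 0
      ≡⟨ cong (_+_ shifted) (sym top≡0) ⟩
    sumTo (suc M) (λ n → term (suc n))
      ≡⟨ sumTo-cong (suc M) (λ n → cong (+ multichoose (suc n) K *_) (sym (t*Σ₁-weight⊛P s n (suc M)))) ⟩
    ⟦ (λ n → t ⊛ Σ₁ s (λ x → weight (suc s) x n)) ⟧ (suc M) K
      ≡⟨ ⟦t⊛⟧≡⟦tₜ⊛⟧ (λ n → Σ₁ s (λ x → weight (suc s) x n)) (suc M) K ⟩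
    ⟦ (λ n → tₜ ⊛ Σ₁ s (λ x → weight (suc s) x n)) ⟧ (suc M) K
      ≡⟨ ⟦tₜ⊛⟧-suc (λ n → Σ₁ s (λ x → weight (suc s) x n)) M K ⟩
    ⟦ (λ n → Σ₁ s (λ x → weight (suc s) x n)) ⟧ M K
      ≡⟨ ⟦⟧-Σ₁ s (weight (suc s)) M K ⟩
    Σ₁ℤ s (λ x → seriesCount M K (suc s) x) ∎
    where
    open ≡-Reasoning
    term : ℕ → ℤ
    term n = + multichoose n K * (+ multichoose s n * P n (suc M))
    shifted = sumTo M (λ n → term (suc n))
    top≡0 : term (suc (suc M)) ≡ + 0
    top≡0 = trans (cong (λ x → + multichoose (suc (suc M)) K * (+ multichoose s (suc (suc M)) * x))
                        (P-vanishesBelow (suc (suc M)) (suc M) ℕ.≤-refl))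
              (trans (cong (+ multichoose (suc (suc M)) K *_) (ℤ.*-zeroʳ (+ multichoose s (suc (suc M)))))
                     (ℤ.*-zeroʳ (+ multichoose (suc (suc M)) K)))

  seriesCount-suc-zero : ∀ s M → seriesCount (suc M) 0 s 0 ≡ Σ₁ℤ s (λ x → seriesCount M 0 (suc s) x)
  seriesCount-suc-zero s M = begin
    seriesCount (suc M) 0 s 0
      ≡⟨ seriesCount-l0 s (suc M) 0 ⟩
    sumTo (suc M) (λ n → + multichoose (suc n) 0 * (+ multichoose s n * P n (suc M)))
      ≡⟨ sumTo-cong (suc M) (λ n → cong (λ k → + k * (+ multichoose s n * P n (suc M))) (sym (multichoose-0 n))) ⟩
    sumTo (suc M) (λ n → + multichoose n 0 * (+ multichoose s n * P n (suc M)))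
      ≡⟨ Σ₁-seriesCount s M 0 ⟩
    Σ₁ℤ s (λ x → seriesCount M 0 (suc s) x) ∎
    where open ≡-Reasoning

  seriesCount-suc-suc : ∀ s M K →
    seriesCount (suc M) (suc K) s 0 ≡ seriesCount (suc M) K s 0 + Σ₁ℤ s (λ x → seriesCount M (suc K) (suc s) x)
  seriesCount-suc-suc s M K = begin
    seriesCount (suc M) (suc K) s 0
      ≡⟨ seriesCount-l0 s (suc M) (suc K) ⟩
    sumTo (suc M) (λ n → + (multichoose n (suc K) ℕ.+ multichoose (suc n) K) * b n)
      ≡⟨ sumTo-cong (suc M) (λ n → trans (cong (_* b n) (sym (ℤ.pos-+ (multichoose n (suc K)) (multichoose (suc n) K))))
                                          (ℤ.*-distribʳ-+ (b n) (+ multichoose n (suc K)) (+ multichoose (suc n) K))) ⟩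
    sumTo (suc M) (λ n → + multichoose n (suc K) * b n + + multichoose (suc n) K * b n)
      ≡⟨ sumTo-+ (suc M) (λ n → + multichoose n (suc K) * b n) (λ n → + multichoose (suc n) K * b n) ⟩
    sumTo (suc M) (λ n → + multichoose n (suc K) * b n) + sumTo (suc M) (λ n → + multichoose (suc n) K * b n)
      ≡⟨ ℤ.+-comm (sumTo (suc M) (λ n → + multichoose n (suc K) * b n)) _ ⟩
    sumTo (suc M) (λ n → + multichoose (suc n) K * b n) + sumTo (suc M) (λ n → + multichoose n (suc K) * b n)
      ≡⟨ cong₂ _+_ (sym (seriesCount-l0 s (suc M) K)) (Σ₁-seriesCount s M (suc K)) ⟩
    seriesCount (suc M) K s 0 + Σ₁ℤ s (λ x → seriesCount M (suc K) (suc s) x) ∎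
    where
    open ≡-Reasoning
    b : ℕ → ℤ
    b n = + multichoose s n * P n (suc M)

module Counting where

  open Series-count using (Σ₁ℤ; seriesCount; seriesCount-zero-zero; seriesCount-suc-zero; seriesCount-suc-suc;
                           seriesCount-shift₀; seriesCount-shift)
  open import Data.Nat as ℕ using (ℕ; zero; suc; _≤_; _<_; z≤n; s≤s; _<ᵇ_)
  import Data.Nat.Properties as ℕ
  open import Data.Nat.Tactic.RingSolver using (solve-∀)
  open import Data.Integer using (ℤ; +_; _+_)
  import Data.Integer.Properties as ℤ
  open import Algebra.Properties.AbelianGroup ℤ.+-0-abelianGroup using (∙-cancelʳ)
  open import Data.Bool using (if_then_else_)
  open import Relation.Binary.PropositionalEquality
  open ≡-Reasoning
  open import Relation.Nullary using (yes; no; contradiction)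
  open import Function using (_∘_)
  open Sum-from-one ℕ._+_ 0 renaming (Σ₁ to Σ₁ℕ) public

  ascBit : ℕ → ℕ → ℕ
  ascBit l x = if l <ᵇ x then 1 else 0

  nextBound : ℕ → ℕ → ℕ → ℕ
  nextBound s l x = ascBit l x ℕ.+ s

  nextBound-zero : ∀ s x → 1 ≤ x → nextBound s 0 x ≡ suc s
  nextBound-zero s (suc x) _ = refl

  ascBit-suc : ∀ l x → x ≢ suc l → ascBit (suc l) x ≡ ascBit l x
  ascBit-suc l       zero          _    = refl
  ascBit-suc zero    (suc zero)    x≢1  = contradiction refl x≢1
  ascBit-suc zero    (suc (suc x)) _    = refl
  ascBit-suc (suc l) (suc x)       x≢l+2 = ascBit-suc l x (x≢l+2 ∘ cong suc)

  -- count M K s l is the number of words with M nonzero letters and K zeros whose letters respect the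
  -- ascent bound, starting from bound s after the letter l.
  count : ℕ → ℕ → ℕ → ℕ → ℕ
  count zero    zero    s l = 1
  count zero    (suc K) s l = count zero K s 0
  count (suc M) zero    s l = Σ₁ℕ s (λ x → count M zero (nextBound s l x) x)
  count (suc M) (suc K) s l = count (suc M) K s 0 ℕ.+ Σ₁ℕ s (λ x → count M (suc K) (nextBound s l x) x)

  Σ₁ℕ-cong≤ : ∀ k {f g : ℕ → ℕ} → (∀ x → x ≤ k → f x ≡ g x) → Σ₁ℕ k f ≡ Σ₁ℕ k g
  Σ₁ℕ-cong≤ zero    eq = refl
  Σ₁ℕ-cong≤ (suc k) eq = cong₂ ℕ._+_ (Σ₁ℕ-cong≤ k (λ x x≤k → eq x (ℕ.m≤n⇒m≤1+n x≤k))) (eq (suc k) ℕ.≤-refl)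

  exchange : ∀ x y z → (x ℕ.+ y) ℕ.+ z ≡ (x ℕ.+ z) ℕ.+ y
  exchange = solve-∀

  Σ₁ℕ-swap : ∀ k a (f g : ℕ → ℕ) → suc a ≤ k → (∀ x → x ≢ suc a → f x ≡ g x) →
    Σ₁ℕ k f ℕ.+ g (suc a) ≡ Σ₁ℕ k g ℕ.+ f (suc a)
  Σ₁ℕ-swap (suc k) a f g a<1+k f≗g with a ℕ.≟ k
  ... | yes refl = begin
    (Σ₁ℕ a f ℕ.+ f (suc a)) ℕ.+ g (suc a)   ≡⟨ cong (λ s → (s ℕ.+ f (suc a)) ℕ.+ g (suc a)) below ⟩
    (Σ₁ℕ a g ℕ.+ f (suc a)) ℕ.+ g (suc a)   ≡⟨ exchange (Σ₁ℕ a g) (f (suc a)) (g (suc a)) ⟩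
    (Σ₁ℕ a g ℕ.+ g (suc a)) ℕ.+ f (suc a)   ∎
    where
    below : Σ₁ℕ a f ≡ Σ₁ℕ a g
    below = Σ₁ℕ-cong≤ a (λ x x≤a → f≗g x (ℕ.<⇒≢ (s≤s x≤a)))
  ... | no a≢k = begin
    (Σ₁ℕ k f ℕ.+ f (suc k)) ℕ.+ g (suc a)   ≡⟨ cong (λ y → (Σ₁ℕ k f ℕ.+ y) ℕ.+ g (suc a)) (f≗g (suc k) (a≢k ∘ sym ∘ ℕ.suc-injective)) ⟩
    (Σ₁ℕ k f ℕ.+ g (suc k)) ℕ.+ g (suc a)   ≡⟨ exchange (Σ₁ℕ k f) (g (suc k)) (g (suc a)) ⟩
    (Σ₁ℕ k f ℕ.+ g (suc a)) ℕ.+ g (suc k)   ≡⟨ cong (ℕ._+ g (suc k)) (Σ₁ℕ-swap k a f g a<k f≗g) ⟩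
    (Σ₁ℕ k g ℕ.+ f (suc a)) ℕ.+ g (suc k)   ≡⟨ exchange (Σ₁ℕ k g) (f (suc a)) (g (suc k)) ⟩
    (Σ₁ℕ k g ℕ.+ g (suc k)) ℕ.+ f (suc a)   ∎
    where
    a<k : suc a ≤ k
    a<k = ℕ.≤-pred (ℕ.≤∧≢⇒< a<1+k (a≢k ∘ ℕ.suc-injective))

  ascBit-self : ∀ l → ascBit l l ≡ 0
  ascBit-self zero    = refl
  ascBit-self (suc l) = ascBit-self l

  ascBit-suc-self : ∀ l → ascBit l (suc l) ≡ 1
  ascBit-suc-self zero    = refl
  ascBit-suc-self (suc l) = ascBit-suc-self l

  -- Raising the previous letter from l to l + 1 only changes whether the next letter l + 1 is an ascent.
  Σ₁-successors-shift : ∀ s l (h : ℕ → ℕ → ℕ) → l < s →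
    Σ₁ℕ s (λ x → h (nextBound s l x) x) ℕ.+ h s (suc l) ≡ Σ₁ℕ s (λ x → h (nextBound s (suc l) x) x) ℕ.+ h (suc s) (suc l)
  Σ₁-successors-shift s l h l<s
    with Σ₁ℕ-swap s l (λ x → h (nextBound s l x) x) (λ x → h (nextBound s (suc l) x) x) l<s
           (λ x x≢1+l → cong (λ b → h (b ℕ.+ s) x) (sym (ascBit-suc l x x≢1+l)))
  ... | swap rewrite ascBit-self (suc l) | ascBit-suc-self l = swap

  count-shift : ∀ s l M K → l < s →
    count (suc M) K s l ℕ.+ count M K s (suc l) ≡ count (suc M) K s (suc l) ℕ.+ count M K (suc s) (suc l)
  count-shift s l M zero    l<s = Σ₁-successors-shift s l (count M zero) l<s
  count-shift s l M (suc K) l<s =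
    trans (ℕ.+-assoc r _ _) (trans (cong (r ℕ.+_) (Σ₁-successors-shift s l (count M (suc K)) l<s)) (sym (ℕ.+-assoc r _ _)))
    where r = count (suc M) K s 0

  count-zero-irrelevant : ∀ K s l l′ → count zero K s l ≡ count zero K s l′
  count-zero-irrelevant zero    s l l′ = refl
  count-zero-irrelevant (suc K) s l l′ = refl

  Σ₁ℤ≡Σ₁ℕ : ∀ k (f : ℕ → ℤ) (g : ℕ → ℕ) → (∀ x → 1 ≤ x → x ≤ k → f x ≡ + g x) → Σ₁ℤ k f ≡ + Σ₁ℕ k g
  Σ₁ℤ≡Σ₁ℕ zero    f g eq = refl
  Σ₁ℤ≡Σ₁ℕ (suc k) f g eq =
    trans (cong₂ _+_ (Σ₁ℤ≡Σ₁ℕ k f g (λ x 1≤x x≤k → eq x 1≤x (ℕ.m≤n⇒m≤1+n x≤k))) (eq (suc k) (s≤s z≤n) ℕ.≤-refl))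
    (sym (ℤ.pos-+ (Σ₁ℕ k g) (g (suc k))))

  -- Both sides obey the same recursion: in M and K for l = 0, and the shift relation in l.
  seriesCount≡count : ∀ M K s l → l ≤ s → seriesCount M K s l ≡ + count M K s l
  seriesCount≡count zero    zero    s zero    _   = seriesCount-zero-zero s
  seriesCount≡count zero    (suc K) s zero    _   = seriesCount≡count zero K s zero z≤n
  seriesCount≡count (suc M) zero    s zero    _   =
    trans (seriesCount-suc-zero s M) (Σ₁ℤ≡Σ₁ℕ s _ _ (λ x 1≤x x≤s →
      trans (seriesCount≡count M zero (suc s) x (ℕ.m≤n⇒m≤1+n x≤s))
            (cong (λ s′ → + count M zero s′ x) (sym (nextBound-zero s x 1≤x)))))
  seriesCount≡count (suc M) (suc K) s zero    _   =
    trans (seriesCount-suc-suc s M K)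
      (trans (cong₂ _+_ (seriesCount≡count (suc M) K s zero z≤n) (Σ₁ℤ≡Σ₁ℕ s _ _ (λ x 1≤x x≤s →
        trans (seriesCount≡count M (suc K) (suc s) x (ℕ.m≤n⇒m≤1+n x≤s))
              (cong (λ s′ → + count M (suc K) s′ x) (sym (nextBound-zero s x 1≤x))))))
      (sym (ℤ.pos-+ (count (suc M) K s 0) _)))
  seriesCount≡count zero    K       s (suc l) l<s =
    trans (sym (seriesCount-shift₀ s l K l<s))
      (trans (seriesCount≡count zero K s l (ℕ.<⇒≤ l<s)) (cong +_ (count-zero-irrelevant K s l (suc l))))
  seriesCount≡count (suc M) K       s (suc l) l<s = ∙-cancelʳ (+ count M K (suc s) (suc l)) _ _ (begin
    seriesCount (suc M) K s (suc l) + + count M K (suc s) (suc l)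
      ≡⟨ cong (_+_ (seriesCount (suc M) K s (suc l))) (sym (seriesCount≡count M K (suc s) (suc l) (ℕ.m≤n⇒m≤1+n l<s))) ⟩
    seriesCount (suc M) K s (suc l) + seriesCount M K (suc s) (suc l)
      ≡⟨ seriesCount-shift s l M K l<s ⟨
    seriesCount (suc M) K s l + seriesCount M K s (suc l)
      ≡⟨ cong₂ _+_ (seriesCount≡count (suc M) K s l (ℕ.<⇒≤ l<s)) (seriesCount≡count M K s (suc l) l<s) ⟩
    + count (suc M) K s l + + count M K s (suc l)
      ≡⟨ ℤ.pos-+ (count (suc M) K s l) (count M K s (suc l)) ⟨
    + (count (suc M) K s l ℕ.+ count M K s (suc l))
      ≡⟨ cong +_ (count-shift s l M K l<s) ⟩
    + (count (suc M) K s (suc l) ℕ.+ count M K (suc s) (suc l))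
      ≡⟨ ℤ.pos-+ (count (suc M) K s (suc l)) (count M K (suc s) (suc l)) ⟩
    + count (suc M) K s (suc l) + + count M K (suc s) (suc l) ∎)

module Enumeration where

  open import Defs using (asc; zeros)
  open Counting using (ascBit; nextBound; count; Σ₁ℕ)
  open import Data.Nat as ℕ using (ℕ; zero; suc; _≤_; z≤n; s≤s)
  import Data.Nat.Properties as ℕ
  open import Data.List using (List; []; _∷_; _++_; length; map)
  import Data.List.Properties as List
  open import Data.List.Membership.Propositional using (_∈_)
  open import Data.List.Membership.Propositional.Properties using (∈-map⁺; ∈-map⁻; ∈-++⁺ˡ; ∈-++⁺ʳ; ∈-++⁻)
  open import Data.List.Relation.Unary.Any using (here)
  open import Data.List.Relation.Unary.Unique.Propositional using (Unique)
  import Data.List.Relation.Unary.Unique.Propositional.Properties as Unique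
  open import Data.List.Relation.Unary.All using ([])
  open import Data.List.Relation.Unary.AllPairs using ([]; _∷_)
  open import Data.Product using (Σ-syntax; _×_; _,_; proj₁; proj₂)
  open import Data.Sum using (inj₁; inj₂)
  open import Relation.Binary.PropositionalEquality
  open import Relation.Nullary using (¬_; yes; no; contradiction)
  open Sum-from-one {A = List (List ℕ)} _++_ [] renaming (Σ₁ to ⋃₁)

  -- Fits s l v: v may follow a prefix ending in the letter l, at which point the bound p + asc is s.
  Fits : ℕ → ℕ → List ℕ → Set
  Fits s l v = ∀ u x v′ → v ≡ u ++ x ∷ v′ → x ≤ s ℕ.+ asc (l ∷ u)

  Counted : ℕ → ℕ → ℕ → ℕ → List ℕ → Set
  Counted M K s l v = Fits s l v × zeros v ≡ K × length v ≡ M ℕ.+ K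

  fits-[] : ∀ s l → Fits s l []
  fits-[] s l []      x v′ ()
  fits-[] s l (_ ∷ _) x v′ ()

  bound-step : ∀ s b a → s ℕ.+ (b ℕ.+ a) ≡ (b ℕ.+ s) ℕ.+ a
  bound-step s b a = trans (sym (ℕ.+-assoc s b a)) (cong (ℕ._+ a) (ℕ.+-comm s b))

  fits-∷⁻ : ∀ s l x v → Fits s l (x ∷ v) → x ≤ s × Fits (nextBound s l x) x v
  fits-∷⁻ s l x v fits = subst (x ≤_) (ℕ.+-identityʳ s) (fits [] x v refl) ,
    λ u y v′ eq → subst (y ≤_) (bound-step s (ascBit l x) (asc (x ∷ u))) (fits (x ∷ u) y v′ (cong (x ∷_) eq))

  fits-∷⁺ : ∀ s l x v → x ≤ s → Fits (nextBound s l x) x v → Fits s l (x ∷ v)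
  fits-∷⁺ s l x v  x≤s fits []      .x .v refl = subst (x ≤_) (sym (ℕ.+-identityʳ s)) x≤s
  fits-∷⁺ s l x ._ x≤s fits (.x ∷ u) y  v′ refl = subst (y ≤_) (sym (bound-step s (ascBit l x) (asc (x ∷ u)))) (fits u y v′ refl)

  zeros≤length : ∀ v → zeros v ≤ length v
  zeros≤length []          = z≤n
  zeros≤length (zero ∷ v)  = s≤s (zeros≤length v)
  zeros≤length (suc _ ∷ v) = ℕ.m≤n⇒m≤1+n (zeros≤length v)

  words : ℕ → ℕ → ℕ → ℕ → List (List ℕ)
  words zero    zero    s l = [] ∷ []
  words zero    (suc K) s l = map (0 ∷_) (words zero K s 0)
  words (suc M) zero    s l = ⋃₁ s (λ x → map (x ∷_) (words M zero (nextBound s l x) x))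
  words (suc M) (suc K) s l = map (0 ∷_) (words (suc M) K s 0) ++ ⋃₁ s (λ x → map (x ∷_) (words M (suc K) (nextBound s l x) x))

  ∈-⋃₁⁻ : ∀ k (L : ℕ → List (List ℕ)) v → v ∈ ⋃₁ k (λ x → map (x ∷_) (L x)) →
    Σ[ x ∈ ℕ ] Σ[ w ∈ List ℕ ] 1 ≤ x × x ≤ k × v ≡ x ∷ w × w ∈ L x
  ∈-⋃₁⁻ zero    L v ()
  ∈-⋃₁⁻ (suc k) L v v∈ with ∈-++⁻ (⋃₁ k (λ x → map (x ∷_) (L x))) v∈
  ... | inj₁ v∈′ = let (x , w , 1≤x , x≤k , eq , w∈) = ∈-⋃₁⁻ k L v v∈′ in x , w , 1≤x , ℕ.m≤n⇒m≤1+n x≤k , eq , w∈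
  ... | inj₂ v∈′ = let (w , w∈ , eq) = ∈-map⁻ (suc k ∷_) v∈′ in suc k , w , s≤s z≤n , ℕ.≤-refl , eq , w∈

  ∈-⋃₁⁺ : ∀ k (f : ℕ → List (List ℕ)) x v → 1 ≤ x → x ≤ k → v ∈ f x → v ∈ ⋃₁ k f
  ∈-⋃₁⁺ zero    f .zero v () z≤n v∈
  ∈-⋃₁⁺ (suc k) f x v 1≤x x≤1+k v∈ with x ℕ.≟ suc k
  ... | yes refl = ∈-++⁺ʳ (⋃₁ k f) v∈
  ... | no  x≢   = ∈-++⁺ˡ (∈-⋃₁⁺ k f x v 1≤x (ℕ.≤-pred (ℕ.≤∧≢⇒< x≤1+k x≢)) v∈)

  length-⋃₁-∷ : ∀ k (L : ℕ → List (List ℕ)) (n : ℕ → ℕ) → (∀ x → length (L x) ≡ n x) →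
    length (⋃₁ k (λ x → map (x ∷_) (L x))) ≡ Σ₁ℕ k n
  length-⋃₁-∷ zero    L n eq = refl
  length-⋃₁-∷ (suc k) L n eq = trans (List.length-++ (⋃₁ k (λ x → map (x ∷_) (L x))))
    (cong₂ ℕ._+_ (length-⋃₁-∷ k L n eq) (trans (List.length-map (suc k ∷_) (L (suc k))) (eq (suc k))))

  length-words : ∀ M K s l → length (words M K s l) ≡ count M K s l
  length-words zero    zero    s l = refl
  length-words zero    (suc K) s l = trans (List.length-map (0 ∷_) (words zero K s 0)) (length-words zero K s 0)
  length-words (suc M) zero    s l =
    length-⋃₁-∷ s (λ x → words M zero (nextBound s l x) x) _ (λ x → length-words M zero (nextBound s l x) x)
  length-words (suc M) (suc K) s l = trans (List.length-++ (map (0 ∷_) (words (suc M) K s 0)))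
    (cong₂ ℕ._+_ (trans (List.length-map (0 ∷_) (words (suc M) K s 0)) (length-words (suc M) K s 0))
                 (length-⋃₁-∷ s (λ x → words M (suc K) (nextBound s l x) x) _ (λ x → length-words M (suc K) (nextBound s l x) x)))

  counted-0∷ : ∀ M K s l w → Counted M K s 0 w → Counted M (suc K) s l (0 ∷ w)
  counted-0∷ M K s l w (fits , z , len) = fits-∷⁺ s l 0 w z≤n fits , cong suc z , trans (cong suc len) (sym (ℕ.+-suc M K))

  counted-x∷ : ∀ M K s l x w → 1 ≤ x → x ≤ s → Counted M K (nextBound s l x) x w → Counted (suc M) K s l (x ∷ w)
  counted-x∷ M K s l (suc y) w _ x≤s (fits , z , len) = fits-∷⁺ s l (suc y) w x≤s fits , z , cong suc len

  words-sound : ∀ M K s l v → v ∈ words M K s l → Counted M K s l v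
  words-sound zero zero s l .[] (here refl) = fits-[] s l , refl , refl
  words-sound zero (suc K) s l v v∈ =
    let (w , w∈ , eq) = ∈-map⁻ (0 ∷_) v∈
    in subst (Counted zero (suc K) s l) (sym eq) (counted-0∷ zero K s l w (words-sound zero K s 0 w w∈))
  words-sound (suc M) zero s l v v∈ =
    let (x , w , 1≤x , x≤s , eq , w∈) = ∈-⋃₁⁻ s (λ x → words M zero (nextBound s l x) x) v v∈
    in subst (Counted (suc M) zero s l) (sym eq) (counted-x∷ M zero s l x w 1≤x x≤s (words-sound M zero (nextBound s l x) x w w∈))
  words-sound (suc M) (suc K) s l v v∈ with ∈-++⁻ (map (0 ∷_) (words (suc M) K s 0)) v∈
  ... | inj₁ v∈′ =
    let (w , w∈ , eq) = ∈-map⁻ (0 ∷_) v∈′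
    in subst (Counted (suc M) (suc K) s l) (sym eq) (counted-0∷ (suc M) K s l w (words-sound (suc M) K s 0 w w∈))
  ... | inj₂ v∈′ =
    let (x , w , 1≤x , x≤s , eq , w∈) = ∈-⋃₁⁻ s (λ x → words M (suc K) (nextBound s l x) x) v v∈′
    in subst (Counted (suc M) (suc K) s l) (sym eq)
             (counted-x∷ M (suc K) s l x w 1≤x x≤s (words-sound M (suc K) (nextBound s l x) x w w∈))

  words-complete : ∀ M K s l v → Counted M K s l v → v ∈ words M K s l
  words-complete zero    zero    s l []      _                   = here refl
  words-complete zero    (suc K) s l []      (_ , () , _)
  words-complete (suc M) K       s l []      (_ , _ , ())
  words-complete M       zero    s l (zero ∷ w) (_ , () , _)
  words-complete M       (suc K) s l (zero ∷ w) (fits , z , len) = into-zero-branch M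
    (∈-map⁺ (0 ∷_) (words-complete M K s 0 w (fits-∷⁻ s l 0 w fits .proj₂ , ℕ.suc-injective z , ℕ.suc-injective (trans len (ℕ.+-suc M K)))))
    where
    into-zero-branch : ∀ M → 0 ∷ w ∈ map (0 ∷_) (words M K s 0) → 0 ∷ w ∈ words M (suc K) s l
    into-zero-branch zero    w∈ = w∈
    into-zero-branch (suc M) w∈ = ∈-++⁺ˡ w∈
  words-complete zero    K       s l (suc y ∷ w) (_ , z , len) =
    contradiction (s≤s (subst (_≤ length w) z (zeros≤length w))) (ℕ.<-irrefl (sym len))
  words-complete (suc M) K       s l (suc y ∷ w) (fits , z , len) = into-nonzero-branch K
    (∈-⋃₁⁺ s (λ x → map (x ∷_) (words M K (nextBound s l x) x)) (suc y) (suc y ∷ w) (s≤s z≤n) y<s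
      (∈-map⁺ (suc y ∷_) (words-complete M K (nextBound s l (suc y)) (suc y) w (fits′ , z , ℕ.suc-injective len))))
    where
    y<s = fits-∷⁻ s l (suc y) w fits .proj₁
    fits′ = fits-∷⁻ s l (suc y) w fits .proj₂
    into-nonzero-branch : ∀ K → suc y ∷ w ∈ ⋃₁ s (λ x → map (x ∷_) (words M K (nextBound s l x) x)) →
                          suc y ∷ w ∈ words (suc M) K s l
    into-nonzero-branch zero    w∈ = w∈
    into-nonzero-branch (suc K) w∈ = ∈-++⁺ʳ (map (0 ∷_) (words (suc M) K s 0)) w∈

  ⋃₁-unique : ∀ k (L : ℕ → List (List ℕ)) → (∀ x → Unique (L x)) → Unique (⋃₁ k (λ x → map (x ∷_) (L x)))
  ⋃₁-unique zero    L unique = []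
  ⋃₁-unique (suc k) L unique = Unique.++⁺ (⋃₁-unique k L unique) (Unique.map⁺ List.∷-injectiveʳ (unique (suc k))) disjoint
    where
    disjoint : ∀ {v} → ¬ (v ∈ ⋃₁ k (λ x → map (x ∷_) (L x)) × v ∈ map (suc k ∷_) (L (suc k)))
    disjoint (v∈ , v∈′) =
      let (x , w , _ , x≤k , eq , _) = ∈-⋃₁⁻ k L _ v∈
          (w′ , _ , eq′) = ∈-map⁻ (suc k ∷_) v∈′
      in ℕ.<-irrefl refl (subst (_≤ k) (List.∷-injectiveˡ (trans (sym eq) eq′)) x≤k)

  words-unique : ∀ M K s l → Unique (words M K s l)
  words-unique zero    zero    s l = [] ∷ []
  words-unique zero    (suc K) s l = Unique.map⁺ List.∷-injectiveʳ (words-unique zero K s 0)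
  words-unique (suc M) zero    s l =
    ⋃₁-unique s (λ x → words M zero (nextBound s l x) x) (λ x → words-unique M zero (nextBound s l x) x)
  words-unique (suc M) (suc K) s l = Unique.++⁺ (Unique.map⁺ List.∷-injectiveʳ (words-unique (suc M) K s 0))
    (⋃₁-unique s (λ x → words M (suc K) (nextBound s l x) x) (λ x → words-unique M (suc K) (nextBound s l x) x)) disjoint
    where
    disjoint : ∀ {v} → ¬ (v ∈ map (0 ∷_) (words (suc M) K s 0) ×
                          v ∈ ⋃₁ s (λ x → map (x ∷_) (words M (suc K) (nextBound s l x) x)))
    disjoint (v∈ , v∈′) =
      let (w′ , _ , eq′) = ∈-map⁻ (0 ∷_) v∈
          (x , w , 1≤x , _ , eq , _) = ∈-⋃₁⁻ s (λ x → words M (suc K) (nextBound s l x) x) _ v∈′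
      in ℕ.<-irrefl refl (subst (1 ≤_) (List.∷-injectiveˡ (trans (sym eq) eq′)) 1≤x)

module Ascent-words where

  open import Defs using (IsPAscent; asc; zeros)
  open Counting using (count)
  open Enumeration
  open import Data.Nat as ℕ using (ℕ; zero; suc; _∸_; _≤_)
  import Data.Nat.Properties as ℕ
  open import Data.List using (List; []; _∷_; _++_; length; map)
  open import Data.List.Properties using (length-map; ∷-injectiveʳ)
  open import Data.List.Membership.Propositional using (_∈_)
  open import Data.List.Membership.Propositional.Properties using (∈-map⁺; ∈-map⁻)
  open import Data.List.Relation.Unary.Any using (here)
  open import Data.List.Relation.Unary.Unique.Propositional using (Unique)
  import Data.List.Relation.Unary.Unique.Propositional.Properties as Unique
  open import Data.List.Relation.Unary.All using ([])
  open import Data.List.Relation.Unary.AllPairs using ([]; _∷_)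
  open import Data.Product using (_×_; _,_)
  open import Relation.Binary.PropositionalEquality
  open import Relation.Nullary using (¬_; yes; no; contradiction)

  isPAscent-[] : ∀ p → IsPAscent p []
  isPAscent-[] p = (λ _ _ ()) , (λ { [] _ _ () _ ; (_ ∷ _) _ _ () _ })

  isPAscent-∷⁻ : ∀ p x v → IsPAscent p (x ∷ v) → x ≡ 0 × Fits p 0 v
  isPAscent-∷⁻ p x v (head≡0 , bounded) with head≡0 x v refl
  ... | refl = refl , λ u y v′ eq → bounded (0 ∷ u) y v′ (cong (0 ∷_) eq) (λ ())

  isPAscent-∷⁺ : ∀ p v → Fits p 0 v → IsPAscent p (0 ∷ v)
  isPAscent-∷⁺ p v fits = (λ { _ _ refl → refl }) , bounded
    where
    bounded : ∀ u x v′ → 0 ∷ v ≡ u ++ x ∷ v′ → u ≢ [] → x ≤ p ℕ.+ asc u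
    bounded []         x v′ eq   u≢[] = contradiction refl u≢[]
    bounded (.0 ∷ u)   x v′ refl _    = fits u x v′ refl

  IsAscentWord : ℕ → ℕ → ℕ → List ℕ → Set
  IsAscentWord p n k w = IsPAscent p w × length w ≡ n × zeros w ≡ k

  -- A nonempty p-ascent sequence is 0 followed by a word fitting bound p after the letter 0.
  ascentWords : ℕ → ℕ → ℕ → List (List ℕ)
  ascentWords p zero    zero    = [] ∷ []
  ascentWords p zero    (suc k) = []
  ascentWords p (suc n) zero    = []
  ascentWords p (suc n) (suc k) with k ℕ.≤? n
  ... | yes _ = map (0 ∷_) (words (n ∸ k) k p 0)
  ... | no  _ = []

  ascentWords-unique : ∀ p n k → Unique (ascentWords p n k)
  ascentWords-unique p zero    zero    = [] ∷ []
  ascentWords-unique p zero    (suc k) = []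
  ascentWords-unique p (suc n) zero    = []
  ascentWords-unique p (suc n) (suc k) with k ℕ.≤? n
  ... | yes _ = Unique.map⁺ ∷-injectiveʳ (words-unique (n ∸ k) k p 0)
  ... | no  _ = []

  ascentWords-sound : ∀ p n k w → w ∈ ascentWords p n k → IsAscentWord p n k w
  ascentWords-sound p zero    zero    .[] (here refl) = isPAscent-[] p , refl , refl
  ascentWords-sound p (suc n) (suc k) w   w∈ with k ℕ.≤? n
  ... | yes k≤n =
    let (v , v∈ , eq) = ∈-map⁻ (0 ∷_) w∈
        (fits , z , len) = words-sound (n ∸ k) k p 0 v v∈
    in subst (IsAscentWord p (suc n) (suc k)) (sym eq)
             (isPAscent-∷⁺ p v fits , cong suc (trans len (ℕ.m∸n+n≡m k≤n)) , cong suc z)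

  ascentWords-complete : ∀ p n k w → IsAscentWord p n k w → w ∈ ascentWords p n k
  ascentWords-complete p zero    zero    []      _            = here refl
  ascentWords-complete p zero    (suc k) []      (_ , _ , ())
  ascentWords-complete p (suc n) k       []      (_ , () , _)
  ascentWords-complete p n       k       (x ∷ v) (ascent , len , z) with isPAscent-∷⁻ p x v ascent
  ascentWords-complete p (suc n) zero    (.0 ∷ v) (_ , _ , ())   | refl , _
  ascentWords-complete p (suc n) (suc k) (.0 ∷ v) (_ , len , z) | refl , fits with k ℕ.≤? n
  ... | yes k≤n = ∈-map⁺ (0 ∷_) (words-complete (n ∸ k) k p 0 v
                    (fits , ℕ.suc-injective z , trans (ℕ.suc-injective len) (sym (ℕ.m∸n+n≡m k≤n))))
  ... | no  k≰n = contradiction (subst₂ _≤_ (ℕ.suc-injective z) (ℕ.suc-injective len) (zeros≤length v)) k≰n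

  length-ascentWords : ∀ p n k → k ≤ n → length (ascentWords p (suc n) (suc k)) ≡ count (n ∸ k) k p 0
  length-ascentWords p n k k≤n with k ℕ.≤? n
  ... | yes _   = trans (length-map (0 ∷_) (words (n ∸ k) k p 0)) (length-words (n ∸ k) k p 0)
  ... | no  k≰n = contradiction k≤n k≰n

  length-ascentWords-> : ∀ p n k → ¬ k ≤ n → length (ascentWords p (suc n) (suc k)) ≡ 0
  length-ascentWords-> p n k k≰n with k ℕ.≤? n
  ... | yes k≤n = contradiction k≤n k≰n
  ... | no  _   = refl

module Bivariate where

  open import Defs
  open Finite-sums
  open Series-ring
  open Series-count using (tₜ; qPow; P; multichoose; multichoose-0)
  open import Data.Nat as ℕ using (ℕ; zero; suc; _∸_; _≤_; _<_; z≤n; s≤s)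
  import Data.Nat.Properties as ℕ
  open import Data.Integer using (ℤ; +_; _+_; _*_; _-_)
  import Data.Integer.Properties as ℤ
  open import Algebra.Properties.Ring ℤ.+-*-ring using ([y-z]x≈yx-zx)
  open import Relation.Binary.PropositionalEquality
  open import Relation.Nullary using (yes; no; contradiction)
  open import Function using (_∘_)

  ZFree : FPS → Set
  ZFree g = ∀ a b → g a (suc b) ≡ + 0

  *ₛ-ZFree : ∀ f g → ZFree g → ∀ i j → (f *ₛ g) i j ≡ sumTo i (λ a → f a j * g (i ∸ a) 0)
  *ₛ-ZFree f g g-free i j = sumTo-cong i (λ a →
    trans (sumTo-single j j _ ℕ.≤-refl (λ b b≤j b≢j →
             trans (cong (f a b *_) (trans (cong (g (i ∸ a)) (ℕ.+-∸-assoc 1 (ℕ.≤∧≢⇒< b≤j b≢j))) (g-free (i ∸ a) (j ∸ suc b))))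
                   (ℤ.*-zeroʳ (f a b))))
          (cong (λ x → f a j * g (i ∸ a) x) (ℕ.n∸n≡0 j)))

  ZFree-*ₛ : ∀ f g → ZFree f → ZFree g → ZFree (f *ₛ g)
  ZFree-*ₛ f g f-free g-free a b = trans (*ₛ-ZFree f g g-free a (suc b))
    (sumTo-zero a (λ x _ → trans (cong (_* g (a ∸ x) 0) (f-free x b)) (ℤ.*-zeroˡ (g (a ∸ x) 0))))

  ZFree-oneₛ : ZFree oneₛ
  ZFree-oneₛ zero    b = refl
  ZFree-oneₛ (suc a) b = refl

  ZFree-tₛ : ZFree tₛ
  ZFree-tₛ zero          b = refl
  ZFree-tₛ (suc zero)    b = refl
  ZFree-tₛ (suc (suc a)) b = refl

  ZFree--ₛ : ∀ f g → ZFree f → ZFree g → ZFree (f -ₛ g)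
  ZFree--ₛ f g f-free g-free a b rewrite f-free a b | g-free a b = refl

  ZFree-^ₛ : ∀ f → ZFree f → ∀ n → ZFree (f ^ₛ n)
  ZFree-^ₛ f f-free zero    = ZFree-oneₛ
  ZFree-^ₛ f f-free (suc n) = ZFree-*ₛ f (f ^ₛ n) f-free (ZFree-^ₛ f f-free n)

  ZFree-prodₛ : ∀ n h → (∀ i → ZFree (h i)) → ZFree (prodₛ n h)
  ZFree-prodₛ zero    h h-free = ZFree-oneₛ
  ZFree-prodₛ (suc n) h h-free = ZFree-*ₛ (prodₛ n h) (h (suc n)) (ZFree-prodₛ n h h-free) (h-free (suc n))

  factor : ℕ → FPS
  factor i = oneₛ -ₛ ((oneₛ -ₛ tₛ) ^ₛ i)

  ZFree-prodₛ-factor : ∀ n → ZFree (prodₛ n factor)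
  ZFree-prodₛ-factor n = ZFree-prodₛ n factor (λ i →
    ZFree--ₛ oneₛ ((oneₛ -ₛ tₛ) ^ₛ i) ZFree-oneₛ (ZFree-^ₛ (oneₛ -ₛ tₛ) (ZFree--ₛ oneₛ tₛ ZFree-oneₛ ZFree-tₛ) i))

  atZ⁰ : FPS → Series
  atZ⁰ f i = f i 0

  atZ⁰-oneₛ : atZ⁰ oneₛ ≈ₜ 1ₜ
  atZ⁰-oneₛ zero    = refl
  atZ⁰-oneₛ (suc i) = refl

  atZ⁰-tₛ : atZ⁰ tₛ ≈ₜ tₜ
  atZ⁰-tₛ zero          = refl
  atZ⁰-tₛ (suc zero)    = refl
  atZ⁰-tₛ (suc (suc i)) = refl

  atZ⁰-^ₛ : ∀ n → atZ⁰ ((oneₛ -ₛ tₛ) ^ₛ n) ≈ₜ qPow n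
  atZ⁰-^ₛ zero    = atZ⁰-oneₛ
  atZ⁰-^ₛ (suc n) = ⊛-cong {f = atZ⁰ (oneₛ -ₛ tₛ)} (λ i → cong₂ _-_ (atZ⁰-oneₛ i) (atZ⁰-tₛ i)) (atZ⁰-^ₛ n)

  -- (f *ₛ g) i 0 unfolds to (atZ⁰ f ⊛ atZ⁰ g) i.
  atZ⁰-prodₛ-factor : ∀ n → atZ⁰ (prodₛ n factor) ≈ₜ P n
  atZ⁰-prodₛ-factor zero    = atZ⁰-oneₛ
  atZ⁰-prodₛ-factor (suc n) = ⊛-cong {f = atZ⁰ (prodₛ n factor)} (atZ⁰-prodₛ-factor n)
                                (λ i → cong₂ _-_ (atZ⁰-oneₛ i) (atZ⁰-^ₛ (suc n) i))

  zt : FPS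
  zt = zₛ *ₛ tₛ

  zt-≢1ˡ : ∀ a b → a ≢ 1 → zt a b ≡ + 0
  zt-≢1ˡ a b a≢1 = trans (*ₛ-ZFree zₛ tₛ ZFree-tₛ a b)
    (trans (sumTo-single a 0 _ z≤n (λ { zero _ 0≢0 → contradiction refl 0≢0 ; (suc x) _ _ → refl }))
      (trans (cong (zₛ 0 b *_) (tₛ-≢1 a a≢1)) (ℤ.*-zeroʳ (zₛ 0 b))))
    where
    tₛ-≢1 : ∀ a → a ≢ 1 → tₛ a 0 ≡ + 0
    tₛ-≢1 zero          _    = refl
    tₛ-≢1 (suc zero)    a≢1 = contradiction refl a≢1
    tₛ-≢1 (suc (suc a)) _    = refl

  zt-≢1ʳ : ∀ a b → b ≢ 1 → zt a b ≡ + 0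
  zt-≢1ʳ a b b≢1 = trans (*ₛ-ZFree zₛ tₛ ZFree-tₛ a b)
    (sumTo-zero a (λ x _ → trans (cong (_* tₛ (a ∸ x) 0) (zₛ-≢1 x b b≢1)) (ℤ.*-zeroˡ (tₛ (a ∸ x) 0))))
    where
    zₛ-≢1 : ∀ a b → b ≢ 1 → zₛ a b ≡ + 0
    zₛ-≢1 zero    zero          _    = refl
    zₛ-≢1 zero    (suc zero)    b≢1 = contradiction refl b≢1
    zₛ-≢1 zero    (suc (suc b)) _    = refl
    zₛ-≢1 (suc a) b             _    = refl

  zt*ₛ-suc : ∀ H i j → (zt *ₛ H) (suc i) (suc j) ≡ H i j
  zt*ₛ-suc H i j =
    trans (sumTo-single (suc i) 1 _ (s≤s z≤n) (λ a _ a≢1 → sumTo-zero (suc j) (λ b _ →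
            trans (cong (_* H (suc i ∸ a) (suc j ∸ b)) (zt-≢1ˡ a b a≢1)) (ℤ.*-zeroˡ (H (suc i ∸ a) (suc j ∸ b))))))
      (trans (sumTo-single (suc j) 1 _ (s≤s z≤n) (λ b _ b≢1 →
              trans (cong (_* H i (suc j ∸ b)) (zt-≢1ʳ 1 b b≢1)) (ℤ.*-zeroˡ (H i (suc j ∸ b)))))
        (ℤ.*-identityˡ (H i j)))

  zt*ₛ-0ˡ : ∀ H j → (zt *ₛ H) 0 j ≡ + 0
  zt*ₛ-0ˡ H j = sumTo-zero j (λ b _ → trans (cong (_* H 0 (j ∸ b)) (zt-≢1ˡ 0 b (λ ()))) (ℤ.*-zeroˡ (H 0 (j ∸ b))))

  zt*ₛ-0ʳ : ∀ H i → (zt *ₛ H) i 0 ≡ + 0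
  zt*ₛ-0ʳ H i = sumTo-zero i (λ a _ → trans (cong (_* H (i ∸ a) 0) (zt-≢1ʳ a 0 (λ ()))) (ℤ.*-zeroˡ (H (i ∸ a) 0)))

  oneₛ-*ₛ : ∀ H i j → (oneₛ *ₛ H) i j ≡ H i j
  oneₛ-*ₛ H i j =
    trans (sumTo-single i 0 _ z≤n (λ { zero _ 0≢0 → contradiction refl 0≢0
                                     ; (suc a) _ _ → sumTo-zero j (λ b _ → ℤ.*-zeroˡ (H (i ∸ suc a) (j ∸ b))) }))
      (trans (sumTo-single j 0 _ z≤n (λ { zero _ 0≢0 → contradiction refl 0≢0 ; (suc b) _ _ → ℤ.*-zeroˡ (H i (j ∸ suc b)) }))
        (ℤ.*-identityˡ (H i j)))

  -ₛ-*ₛ : ∀ f g H i j → ((f -ₛ g) *ₛ H) i j ≡ (f *ₛ H) i j - (g *ₛ H) i j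
  -ₛ-*ₛ f g H i j =
    trans (sumTo-cong i (λ a → trans (sumTo-cong j (λ b → [y-z]x≈yx-zx (H (i ∸ a) (j ∸ b)) (f a b) (g a b)))
                                    (sumTo-sub j (λ b → f a b * H (i ∸ a) (j ∸ b)) (λ b → g a b * H (i ∸ a) (j ∸ b)))))
      (sumTo-sub i (λ a → sumTo j (λ b → f a b * H (i ∸ a) (j ∸ b))) (λ a → sumTo j (λ b → g a b * H (i ∸ a) (j ∸ b))))

  *ₛ-cong : ∀ {f f′ g g′} → f ≈ₛ f′ → g ≈ₛ g′ → (f *ₛ g) ≈ₛ (f′ *ₛ g′)
  *ₛ-cong f≈ g≈ i j = sumTo-cong i (λ a → sumTo-cong j (λ b → cong₂ _*_ (f≈ a b) (g≈ (i ∸ a) (j ∸ b))))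

  diagonal : Series → FPS
  diagonal h zero    zero    = h 0
  diagonal h zero    (suc j) = + 0
  diagonal h (suc i) zero    = + 0
  diagonal h (suc i) (suc j) = diagonal (h ∘ suc) i j

  diagonal-≡ : ∀ h i → diagonal h i i ≡ h i
  diagonal-≡ h zero    = refl
  diagonal-≡ h (suc i) = diagonal-≡ (h ∘ suc) i

  diagonal-≢ : ∀ h i j → i ≢ j → diagonal h i j ≡ + 0
  diagonal-≢ h zero    zero    i≢j = contradiction refl i≢j
  diagonal-≢ h zero    (suc j) i≢j = refl
  diagonal-≢ h (suc i) zero    i≢j = refl
  diagonal-≢ h (suc i) (suc j) i≢j = diagonal-≢ (h ∘ suc) i j (i≢j ∘ cong suc)

  diagonal-cong : ∀ {h h′} → h ≈ₜ h′ → diagonal h ≈ₛ diagonal h′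
  diagonal-cong eq zero    zero    = eq 0
  diagonal-cong eq zero    (suc j) = refl
  diagonal-cong eq (suc i) zero    = refl
  diagonal-cong eq (suc i) (suc j) = diagonal-cong (eq ∘ suc) i j

  sumTo-diagonal-row : ∀ d a n (Y : ℕ → ℤ) → a ≤ n → sumTo n (λ b → diagonal d a b * Y b) ≡ d a * Y a
  sumTo-diagonal-row d a n Y a≤n =
    trans (sumTo-single n a _ a≤n (λ b _ b≢a → trans (cong (_* Y b) (diagonal-≢ d a b (b≢a ∘ sym))) (ℤ.*-zeroˡ (Y b))))
      (cong (_* Y a) (diagonal-≡ d a))

  sumTo-diagonal-row-> : ∀ d a n (Y : ℕ → ℤ) → n < a → sumTo n (λ b → diagonal d a b * Y b) ≡ + 0
  sumTo-diagonal-row-> d a n Y n<a = sumTo-zero n (λ b b≤n →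
    trans (cong (_* Y b) (diagonal-≢ d a b (λ { refl → ℕ.<⇒≱ n<a b≤n }))) (ℤ.*-zeroˡ (Y b)))

  diagonal-*ₛ : ∀ d h → (diagonal d *ₛ diagonal h) ≈ₛ diagonal (d ⊛ h)
  diagonal-*ₛ d h i j with i ℕ.≟ j
  ... | yes refl = trans (sumTo-cong≤ i (λ a a≤i →
                     trans (sumTo-diagonal-row d a i _ a≤i) (cong (d a *_) (diagonal-≡ h (i ∸ a)))))
                     (sym (diagonal-≡ (d ⊛ h) i))
  ... | no  i≢j  = trans (sumTo-zero i row≡0) (sym (diagonal-≢ (d ⊛ h) i j i≢j))
    where
    row≡0 : ∀ a → a ≤ i → sumTo j (λ b → diagonal d a b * diagonal h (i ∸ a) (j ∸ b)) ≡ + 0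
    row≡0 a a≤i with a ℕ.≤? j
    ... | yes a≤j = trans (sumTo-diagonal-row d a j _ a≤j)
                      (trans (cong (d a *_) (diagonal-≢ h (i ∸ a) (j ∸ a) (i≢j ∘ ℕ.∸-cancelʳ-≡ a≤i a≤j))) (ℤ.*-zeroʳ (d a)))
    ... | no  a≰j = sumTo-diagonal-row-> d a j _ (ℕ.≰⇒> a≰j)

  sumTo-multichoose : ∀ r n → sumTo n (λ a → + multichoose r a) ≡ + multichoose (suc r) n
  sumTo-multichoose r zero    = cong +_ (multichoose-0 r)
  sumTo-multichoose r (suc n) = trans (cong (_+ + multichoose r (suc n)) (sumTo-multichoose r n))
    (trans (ℤ.+-comm (+ multichoose (suc r) n) (+ multichoose r (suc n))) (sym (ℤ.pos-+ (multichoose r (suc n)) (multichoose (suc r) n))))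

  ones⊛multichoose : ∀ r → (λ _ → + 1) ⊛ (+_ ∘ multichoose r) ≈ₜ +_ ∘ multichoose (suc r)
  ones⊛multichoose r n = trans (⊛-comm (λ _ → + 1) (+_ ∘ multichoose r) n)
    (trans (sumTo-cong n (λ a → ℤ.*-identityʳ (+ multichoose r a))) (sumTo-multichoose r n))

  diagonal-multichoose-0 : diagonal (+_ ∘ multichoose 0) ≈ₛ oneₛ
  diagonal-multichoose-0 zero    zero    = refl
  diagonal-multichoose-0 zero    (suc j) = refl
  diagonal-multichoose-0 (suc i) zero    = refl
  diagonal-multichoose-0 (suc i) (suc j) = trans (diagonal-cong {h′ = λ _ → + 0} (λ _ → refl) i j) (zero-diagonal i j)
    where
    zero-diagonal : ∀ i j → diagonal (λ _ → + 0) i j ≡ + 0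
    zero-diagonal zero    zero    = refl
    zero-diagonal zero    (suc j) = refl
    zero-diagonal (suc i) zero    = refl
    zero-diagonal (suc i) (suc j) = zero-diagonal i j

  module Geometric (G : FPS) (G-inverse : ((oneₛ -ₛ zt) *ₛ G) ≈ₛ oneₛ) where

    G-recurrence : ∀ i j → G i j - (zt *ₛ G) i j ≡ oneₛ i j
    G-recurrence i j = trans (sym (trans (-ₛ-*ₛ oneₛ zt G i j) (cong (_- (zt *ₛ G) i j) (oneₛ-*ₛ G i j)))) (G-inverse i j)

    G-boundary : ∀ i j → (zt *ₛ G) i j ≡ + 0 → G i j ≡ oneₛ i j
    G-boundary i j zt*G≡0 = trans (sym (ℤ.+-identityʳ (G i j))) (trans (cong (λ x → G i j - x) (sym zt*G≡0)) (G-recurrence i j))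

    G≈diagonal : G ≈ₛ diagonal (λ _ → + 1)
    G≈diagonal zero    zero    = G-boundary 0 0 (zt*ₛ-0ˡ G 0)
    G≈diagonal zero    (suc j) = G-boundary 0 (suc j) (zt*ₛ-0ˡ G (suc j))
    G≈diagonal (suc i) zero    = G-boundary (suc i) 0 (zt*ₛ-0ʳ G (suc i))
    G≈diagonal (suc i) (suc j) =
      trans (ℤ.i-j≡0⇒i≡j _ _ (trans (cong (λ x → G (suc i) (suc j) - x) (sym (zt*ₛ-suc G i j))) (G-recurrence (suc i) (suc j))))
        (G≈diagonal i j)

    G^ₛ≈diagonal : ∀ r → (G ^ₛ r) ≈ₛ diagonal (+_ ∘ multichoose r)
    G^ₛ≈diagonal zero    i j = sym (diagonal-multichoose-0 i j)
    G^ₛ≈diagonal (suc r) i j = begin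
      (G *ₛ (G ^ₛ r)) i j
        ≡⟨ *ₛ-cong G≈diagonal (G^ₛ≈diagonal r) i j ⟩
      (diagonal (λ _ → + 1) *ₛ diagonal (+_ ∘ multichoose r)) i j
        ≡⟨ diagonal-*ₛ (λ _ → + 1) (+_ ∘ multichoose r) i j ⟩
      diagonal ((λ _ → + 1) ⊛ (+_ ∘ multichoose r)) i j
        ≡⟨ diagonal-cong (ones⊛multichoose r) i j ⟩
      diagonal (+_ ∘ multichoose (suc r)) i j ∎
      where open ≡-Reasoning

    zt*G^ₛ-≢ : ∀ m a k → a ≢ suc k → (zt *ₛ (G ^ₛ suc m)) a (suc k) ≡ + 0
    zt*G^ₛ-≢ m zero    k _       = zt*ₛ-0ˡ (G ^ₛ suc m) (suc k)
    zt*G^ₛ-≢ m (suc a) k a+1≢k+1 = trans (zt*ₛ-suc (G ^ₛ suc m) a k)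
      (trans (G^ₛ≈diagonal (suc m) a k) (diagonal-≢ _ a k (a+1≢k+1 ∘ cong suc)))

    zt*G^ₛ-≡ : ∀ m k → (zt *ₛ (G ^ₛ suc m)) (suc k) (suc k) ≡ + multichoose (suc m) k
    zt*G^ₛ-≡ m k = trans (zt*ₛ-suc (G ^ₛ suc m) k k) (trans (G^ₛ≈diagonal (suc m) k k) (diagonal-≡ _ k))

    summand : ℕ → FPS
    summand m = (zt *ₛ (G ^ₛ suc m)) *ₛ prodₛ m factor

    summand-0 : ∀ m i → summand m i 0 ≡ + 0
    summand-0 m i = trans (*ₛ-ZFree (zt *ₛ (G ^ₛ suc m)) (prodₛ m factor) (ZFree-prodₛ-factor m) i 0)
      (sumTo-zero i (λ a _ → trans (cong (_* prodₛ m factor (i ∸ a) 0) (zt*ₛ-0ʳ (G ^ₛ suc m) a)) (ℤ.*-zeroˡ (prodₛ m factor (i ∸ a) 0))))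

    summand-≤ : ∀ m i k → suc k ≤ i → summand m i (suc k) ≡ + multichoose (suc m) k * P m (i ∸ suc k)
    summand-≤ m i k k<i = trans (*ₛ-ZFree (zt *ₛ (G ^ₛ suc m)) (prodₛ m factor) (ZFree-prodₛ-factor m) i (suc k))
      (trans (sumTo-single i (suc k) _ k<i (λ a _ a≢k+1 →
               trans (cong (_* prodₛ m factor (i ∸ a) 0) (zt*G^ₛ-≢ m a k a≢k+1)) (ℤ.*-zeroˡ (prodₛ m factor (i ∸ a) 0))))
        (cong₂ _*_ (zt*G^ₛ-≡ m k) (atZ⁰-prodₛ-factor m (i ∸ suc k))))

    summand-> : ∀ m i k → i < suc k → summand m i (suc k) ≡ + 0
    summand-> m i k i<k+1 = trans (*ₛ-ZFree (zt *ₛ (G ^ₛ suc m)) (prodₛ m factor) (ZFree-prodₛ-factor m) i (suc k))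
      (sumTo-zero i (λ a a≤i → trans (cong (_* prodₛ m factor (i ∸ a) 0)
        (zt*G^ₛ-≢ m a k (λ a≡k+1 → ℕ.<-irrefl a≡k+1 (ℕ.≤-<-trans a≤i i<k+1)))) (ℤ.*-zeroˡ (prodₛ m factor (i ∸ a) 0))))

open import Defs
open import Data.Nat using (ℕ; suc; _≤_; _∸_; _+_)
open import Data.Nat.Combinatorics using (_C_)
open import Data.Integer using (+_)
open import Data.List using (length)
open import Data.Product using (Σ; _×_; _,_)
open import Function.Bundles using (mk⇔)
open import Relation.Binary.PropositionalEquality using (_≡_; refl)

module Ascent-series (p : ℕ) (p≥1 : 1 ≤ p) (G : FPS) (G-inverse : ((oneₛ -ₛ (zₛ *ₛ tₛ)) *ₛ G) ≈ₛ oneₛ) where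

  open Finite-sums
  open Series-count using (P; P-vanishesBelow; multichoose; seriesCount; seriesCount-l0; C≡multichoose)
  open Counting using (count; seriesCount≡count)
  open Ascent-words
  open Bivariate
  open Geometric G G-inverse
  import Data.Integer as ℤ
  import Data.Integer.Properties as ℤ
  import Data.Nat.Properties as ℕ
  open import Data.Nat using (zero; _<_; z≤n; s≤s)
  open import Relation.Binary.PropositionalEquality
  open import Relation.Nullary using (¬_; Dec; yes; no)
  open import Data.Integer.Tactic.RingSolver using (solve-∀)

  binomial : ℕ → ℤ.ℤ
  binomial n = + ((p ∸ 1 + n) C n)

  F : ℕ → FPS
  F n = binomial n •ₛ summand n

  F-vanishes : ∀ m i j → i ≤ m → F m i j ≡ + 0
  F-vanishes m i zero    _   = trans (cong (binomial m ℤ.*_) (summand-0 m i)) (ℤ.*-zeroʳ (binomial m))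
  F-vanishes m i (suc k) i≤m with suc k ℕ.≤? i
  ... | yes k<i = trans (cong (binomial m ℤ.*_) (trans (summand-≤ m i k k<i)
                    (trans (cong (+ multichoose (suc m) k ℤ.*_) (P-vanishesBelow m (i ∸ suc k) (ℕ.<-≤-trans (ℕ.∸-monoʳ-< (s≤s z≤n) k<i) i≤m)))
                      (ℤ.*-zeroʳ (+ multichoose (suc m) k)))))
                    (ℤ.*-zeroʳ (binomial m))
  ... | no  k≮i = trans (cong (binomial m ℤ.*_) (summand-> m i k (ℕ.≰⇒> k≮i))) (ℤ.*-zeroʳ (binomial m))

  partialₛ-sumTo : ∀ N i j → partialₛ F (suc N) i j ≡ sumTo N (λ m → F m i j)
  partialₛ-sumTo zero    i j = ℤ.+-identityˡ _
  partialₛ-sumTo (suc N) i j = cong (ℤ._+ F (suc N) i j) (partialₛ-sumTo N i j)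

  -- Coefficient (i, j) receives no contribution from F m with m ≥ i.
  S : FPS
  S i j = partialₛ F (suc i) i j

  partialₛ-stable : ∀ i j d → partialₛ F (suc i + d) i j ≡ S i j
  partialₛ-stable i j zero    = cong (λ x → partialₛ F x i j) (ℕ.+-identityʳ (suc i))
  partialₛ-stable i j (suc d) = trans (cong (λ x → partialₛ F x i j) (ℕ.+-suc (suc i) d))
    (trans (cong (ℤ._+_ (partialₛ F (suc i + d) i j)) (F-vanishes (suc i + d) i j (ℕ.m≤n⇒m≤1+n (ℕ.m≤m+n i d))))
      (trans (ℤ.+-identityʳ _) (partialₛ-stable i j d)))

  hasSum : HasSum F S
  hasSum i j = suc i , λ M i<M → trans (cong (λ x → partialₛ F x i j) (sym (ℕ.m+[n∸m]≡n i<M))) (partialₛ-stable i j (M ∸ suc i))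

  coefficient-> : ∀ n k → ¬ k ≤ n → (oneₛ +ₛ S) (suc n) (suc k) ≡ + 0
  coefficient-> n k k≰n = trans (ℤ.+-identityˡ _) (trans (partialₛ-sumTo (suc n) (suc n) (suc k))
    (sumTo-zero (suc n) (λ m _ → trans (cong (binomial m ℤ.*_) (summand-> m (suc n) k (s≤s (ℕ.≰⇒> k≰n)))) (ℤ.*-zeroʳ (binomial m)))))

  coefficient-≤ : ∀ n k → k ≤ n → (oneₛ +ₛ S) (suc n) (suc k) ≡ + count (n ∸ k) k p 0
  coefficient-≤ n k k≤n = begin
    + 0 ℤ.+ S (suc n) (suc k)
      ≡⟨ ℤ.+-identityˡ _ ⟩
    partialₛ F (suc (suc n)) (suc n) (suc k)
      ≡⟨ partialₛ-sumTo (suc n) (suc n) (suc k) ⟩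
    sumTo (suc n) (λ m → F m (suc n) (suc k))
      ≡⟨ sumTo-cong (suc n) (λ m → cong (binomial m ℤ.*_) (summand-≤ m (suc n) k (s≤s k≤n))) ⟩
    sumTo (suc n) (λ m → binomial m ℤ.* (+ multichoose (suc m) k ℤ.* P m M))
      ≡⟨ sumTo-truncate M (suc n) _ (ℕ.≤-trans (ℕ.m∸n≤m n k) (ℕ.n≤1+n n)) (λ m M<m _ → tail≡0 m M<m) ⟩
    sumTo M (λ m → binomial m ℤ.* (+ multichoose (suc m) k ℤ.* P m M))
      ≡⟨ sumTo-cong M (λ m → reorder (binomial m) (+ multichoose (suc m) k) (P m M)) ⟩
    sumTo M (λ m → + multichoose (suc m) k ℤ.* (binomial m ℤ.* P m M))
      ≡⟨ sumTo-cong M (λ m → cong (λ b → + multichoose (suc m) k ℤ.* (+ b ℤ.* P m M)) (C≡multichoose p p≥1 m)) ⟩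
    sumTo M (λ m → + multichoose (suc m) k ℤ.* (+ multichoose p m ℤ.* P m M))
      ≡⟨ seriesCount-l0 p M k ⟨
    seriesCount M k p 0
      ≡⟨ seriesCount≡count M k p 0 z≤n ⟩
    + count M k p 0 ∎
    where
    open ≡-Reasoning
    M = n ∸ k
    tail≡0 : ∀ m → M < m → binomial m ℤ.* (+ multichoose (suc m) k ℤ.* P m M) ≡ + 0
    tail≡0 m M<m = trans (cong (λ x → binomial m ℤ.* (+ multichoose (suc m) k ℤ.* x)) (P-vanishesBelow m M M<m))
      (trans (cong (binomial m ℤ.*_) (ℤ.*-zeroʳ (+ multichoose (suc m) k))) (ℤ.*-zeroʳ (binomial m)))
    reorder : ∀ a b c → a ℤ.* (b ℤ.* c) ≡ b ℤ.* (a ℤ.* c)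
    reorder = solve-∀

  coefficient-suc : ∀ n k → Dec (k ≤ n) → (oneₛ +ₛ S) (suc n) (suc k) ≡ + length (ascentWords p (suc n) (suc k))
  coefficient-suc n k (yes k≤n) = trans (coefficient-≤ n k k≤n) (cong +_ (sym (length-ascentWords p n k k≤n)))
  coefficient-suc n k (no  k≰n) = trans (coefficient-> n k k≰n) (cong +_ (sym (length-ascentWords-> p n k k≰n)))

  coefficient : ∀ n k → (oneₛ +ₛ S) n k ≡ + length (ascentWords p n k)
  coefficient zero    zero    = cong (λ x → + 1 ℤ.+ (+ 0 ℤ.+ x)) (F-vanishes 0 0 0 z≤n)
  coefficient zero    (suc k) = cong (λ x → + 0 ℤ.+ (+ 0 ℤ.+ x)) (F-vanishes 0 0 (suc k) z≤n)
  coefficient (suc n) zero    = trans (ℤ.+-identityˡ _) (trans (partialₛ-sumTo (suc n) (suc n) 0)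
    (sumTo-zero (suc n) (λ m _ → trans (cong (binomial m ℤ.*_) (summand-0 m (suc n))) (ℤ.*-zeroʳ (binomial m)))))
  coefficient (suc n) (suc k) = coefficient-suc n k (k ℕ.≤? n)


theorem3p4 : (p : ℕ) → 1 ≤ p → (G : FPS) → ((oneₛ -ₛ (zₛ *ₛ tₛ)) *ₛ G) ≈ₛ oneₛ →
    Σ FPS λ S →
      HasSum (λ n → (+ ((p ∸ 1 + n) C n)) •ₛ
                 (((zₛ *ₛ tₛ) *ₛ (G ^ₛ suc n)) *ₛ prodₛ n (λ i → oneₛ -ₛ ((oneₛ -ₛ tₛ) ^ₛ i)))) S
      × (∀ n k → Σ ℕ λ c →
           CountIs (λ w → IsPAscent p w × length w ≡ n × zeros w ≡ k) c
           × (oneₛ +ₛ S) n k ≡ + c)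
theorem3p4 p p≥1 G G-inverse =
  S , hasSum , λ n k → length (ascentWords p n k) ,
    (ascentWords p n k , ascentWords-unique p n k , (λ w → mk⇔ (ascentWords-sound p n k w) (ascentWords-complete p n k w)) , refl) ,
    coefficient n k
  where
  open Ascent-series p p≥1 G G-inverse
  open Ascent-words
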